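{- Let $d\geq 3$. If $G$ is a finite connected $d$-regular graph of girth $g\geq 3$ on $n$ vertices, then \[ \kappa(G) \leq \frac{n(n(d - 2)+2)}{2\log_{d-1}\left(\frac{n(d-2) + 2}{d}\right)+1} \quad\text{if } g \text{ is odd,} \] and \[ \kappa(G) \leq \frac{nd(n(d -2)+2)}{4\log_{d-1}\left(\frac{n(d-2) + 2}{2}\right)} \quad\text{if } g \text{ is even,} \] with equality if and only if $G$ is a Moore graph.
   Context: Graphs are multigraphs (loops and multiple edges allowed). A walk is a sequence of oriented edges, consecutive ones sharing endpoints; closed walks are considered up to cyclic permutation. A cycle is a closed walk in which each vertex is the initial vertex of at most one edge. A closed geodesic is a closed walk that never immediately backtracks along an edge (cyclically). The girth $g$ is the smallest length of a closed geodesic. The kissing number $\kappa(G)$ is the number of distinct oriented cycles of length $g$ in $G$. A Moore graph is a connected $d$-regular graph of girth $g$ whose number of vertices equals $1 + d \sum_{j=0}^{(g-3)/2} (d-1)^j$ if $g$ is odd, or $2 \sum_{j=0}^{(g-2)/2} (d-1)^j$ if $g$ is even. -}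

module Defs where

open import Data.Nat using (ℕ; zero; suc; _+_; _*_; _∸_; _^_; _≤_; _<_)
open import Data.Nat.DivMod using (_%_; _/_; m%n<n)
open import Data.Fin using (Fin; toℕ; fromℕ<; _≟_)
open import Data.Bool using (Bool; true; false; not; if_then_else_)
open import Data.List using (map; allFin)
open import Data.Nat.ListAction using (sum)
open import Data.Product using (Σ; _×_; proj₁; proj₂; _,_; ∃)
open import Relation.Nullary using (¬_; does)
open import Relation.Binary.PropositionalEquality using (_≡_; _≢_)

-- Finite multigraphs (loops and multiple edges allowed).
-- Vertices are Fin n, edges are Fin m, each edge has two ends.

record Graph : Set where
  field
    n    : ℕ
    m    : ℕ
    ends : Fin m → Fin n × Fin n

open Graph public

-- Oriented edges: an edge together with a chosen orientation.
Dart : Graph → Set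
Dart G = Fin (m G) × Bool

init : (G : Graph) → Dart G → Fin (n G)
init G (e , true)  = proj₁ (ends G e)
init G (e , false) = proj₂ (ends G e)

term : (G : Graph) → Dart G → Fin (n G)
term G (e , true)  = proj₂ (ends G e)
term G (e , false) = proj₁ (ends G e)

rev : (G : Graph) → Dart G → Dart G
rev G (e , b) = (e , not b)

-- degree: number of edge-ends at v (a loop contributes 2)
ind : ∀ {k} → Fin k → Fin k → ℕ
ind a b = if does (a ≟ b) then 1 else 0

deg : (G : Graph) → Fin (n G) → ℕ
deg G v = sum (map (λ e → ind (proj₁ (ends G e)) v + ind (proj₂ (ends G e)) v) (allFin (m G)))

Regular : Graph → ℕ → Set
Regular G d = ∀ v → deg G v ≡ d

data Reach (G : Graph) (u : Fin (n G)) : Fin (n G) → Set where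
  here : Reach G u u
  step : (δ : Dart G) → Reach G u (init G δ) → Reach G u (term G δ)

Connected : Graph → Set
Connected G = ∀ u v → Reach G u v

-- Closed walks of length k: maps Fin k → Dart, indices read cyclically.

shiftBy : ∀ {k} → ℕ → Fin k → Fin k
shiftBy {suc k} r i = fromℕ< (m%n<n (toℕ i + r) (suc k))

next : ∀ {k} → Fin k → Fin k
next = shiftBy 1

Walk : Graph → ℕ → Set
Walk G k = Fin k → Dart G

IsClosedWalk : (G : Graph) (k : ℕ) → Walk G k → Set
IsClosedWalk G k w = ∀ i → term G (w i) ≡ init G (w (next i))

IsClosedGeodesic : (G : Graph) (k : ℕ) → Walk G k → Set
IsClosedGeodesic G k w = IsClosedWalk G k w × (∀ i → w (next i) ≢ rev G (w i))

IsCycle : (G : Graph) (k : ℕ) → Walk G k → Set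
IsCycle G k w = IsClosedWalk G k w × (∀ i j → init G (w i) ≡ init G (w j) → i ≡ j)

RotEquiv : (G : Graph) (k : ℕ) → Walk G k → Walk G k → Set
RotEquiv G k w w' = ∃ λ r → ∀ i → w' i ≡ w (shiftBy r i)

IsGirth : Graph → ℕ → Set
IsGirth G g =
  (1 ≤ g × Σ (Walk G g) (IsClosedGeodesic G g)) ×
  (∀ k → 1 ≤ k → (w : Walk G k) → IsClosedGeodesic G k w → g ≤ k)

Cycle : Graph → ℕ → Set
Cycle G k = Σ (Walk G k) (IsCycle G k)

-- κ is the number of distinct oriented cycles of length g, up to cyclic
-- permutation: a family of κ pairwise non-equivalent cycles of length g
-- representing every cycle of length g.
IsKissingNumber : Graph → ℕ → ℕ → Set
IsKissingNumber G g κ =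
  Σ (Fin κ → Cycle G g) λ c →
    (∀ i j → RotEquiv G g (proj₁ (c i)) (proj₁ (c j)) → i ≡ j) ×
    (∀ (w : Cycle G g) → ∃ λ i → RotEquiv G g (proj₁ (c i)) (proj₁ w))

geomSum : ℕ → ℕ → ℕ
geomSum r zero    = 1
geomSum r (suc t) = geomSum r t + r ^ suc t

MooreSize : ℕ → ℕ → ℕ
MooreSize d g =
  if does (g % 2 Data.Nat.≟ 1)
  then 1 + d * geomSum (d ∸ 1) ((g ∸ 3) / 2)
  else 2 * geomSum (d ∸ 1) ((g ∸ 2) / 2)

IsMoore : Graph → ℕ → ℕ → Set
IsMoore G d g = Connected G × Regular G d × IsGirth G g × n G ≡ MooreSize d g

-- The bounds, with the real logarithm eliminated exactly.
-- Put N = n(d-2)+2.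
-- Odd g, A = n·N, L = log_{d-1}(N/d) ≥ 0 :
--   κ ≤ A/(2L+1)  ⇔  2κL ≤ A-κ  ⇔  (N/d)^{2κ} ≤ (d-1)^{A-κ}
--                 ⇔  κ ≤ A ∧ N^{2κ} ≤ d^{2κ}(d-1)^{A-κ}
-- (same with = for equality).
-- Even g, A = n·d·N, L = log_{d-1}(N/2) > 0 :
--   κ ≤ A/(4L)  ⇔  4κL ≤ A  ⇔  N^{4κ} ≤ 2^{4κ}(d-1)^{A}.

NN : ℕ → ℕ → ℕ
NN n d = n * (d ∸ 2) + 2

OddBound : ℕ → ℕ → ℕ → Set
OddBound n d κ =
  κ ≤ n * NN n d ×
  NN n d ^ (2 * κ) ≤ d ^ (2 * κ) * (d ∸ 1) ^ (n * NN n d ∸ κ)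

OddEquality : ℕ → ℕ → ℕ → Set
OddEquality n d κ =
  κ ≤ n * NN n d ×
  NN n d ^ (2 * κ) ≡ d ^ (2 * κ) * (d ∸ 1) ^ (n * NN n d ∸ κ)

EvenBound : ℕ → ℕ → ℕ → Set
EvenBound n d κ = NN n d ^ (4 * κ) ≤ 2 ^ (4 * κ) * (d ∸ 1) ^ (n * d * NN n d)

EvenEquality : ℕ → ℕ → ℕ → Set
EvenEquality n d κ = NN n d ^ (4 * κ) ≡ 2 ^ (4 * κ) * (d ∸ 1) ^ (n * d * NN n d)

-- Let r = ⌊g/2⌋. A d-regular graph on n vertices has exactly n d (d-1)^r non-backtracking walks of
-- length r + 1, and each of them lies on at most one cycle of length g, up to rotation: two different
-- completions would be two non-backtracking walks of total length 2(g - r - 1) < g between the same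
-- vertices, which close up to a closed non-backtracking walk shorter than the girth. Each of the κ cycles
-- has g starting points, so κ g ≤ n d (d-1)^r. The non-backtracking walks of length at most r from a
-- vertex (g odd), or the corresponding walks from an edge (g even), end at pairwise distinct vertices;
-- this is the Moore bound n ≥ M, and when n = M every vertex is such an end, so every walk of length
-- r + 1 closes up to a cycle of length g and κ g = n d (d-1)^r.
-- With N = n(d-2) + 2 and A = d (d-1)^r (the value of N at n = M; 2(d-1)^r for g even), one has
-- (N/d)^(2A) ≤ (d-1)^(gN - A) for N ≥ A, with equality only at N = A, because (1 + 1/N)^(2A) < (d-1)^g.
-- Raised to the power κ/A and combined with κ g ≤ n A this is the stated bound, with equality only if
-- N = A, that is n = M.

module Submission where

open import Defs
open import Data.Bool using (true; false; if_then_else_)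
import Data.Bool.Properties as Bool
open import Data.Fin using (Fin; zero; suc; toℕ) renaming (_≟_ to _≟ᶠ_)
open import Data.Fin.Properties using (injective⇒≤; toℕ-fromℕ<; toℕ-injective; toℕ<n)
open import Data.List using (List; []; _∷_; _++_; [_]; head; last; initLast; _∷ʳ′_; length; map; concatMap; filter; lookup; allFin; cartesianProductWith)
import Data.List.Properties as List
open import Data.List.Properties using (length-++; length-map; length-tabulate; filter-accept; filter-reject; filter-all)
open import Data.List.Membership.Propositional using (_∈_; lose; find)
open import Data.List.Membership.Propositional.Properties using (∈-lookup; ∈-allFin; ∈-++⁻; ∈-cartesianProductWith⁺; ∈-cartesianProductWith⁻; ∈-concatMap⁺; ∈-concatMap⁻; ∈-filter⁺; ∈-filter⁻; ∈-map⁺; ∈-map⁻)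
open import Data.List.Membership.DecPropositional as DecMembership using ()
open import Data.List.Relation.Binary.Subset.Propositional using (_⊆_)
open import Data.List.Relation.Unary.All as All using ([]; _∷_)
open import Data.List.Relation.Unary.All.Properties using (¬Any⇒All¬) renaming (map⁺ to All-map⁺)
open import Data.List.Relation.Unary.Any using (here; there; index; satisfied)
open import Data.List.Relation.Unary.Any.Properties using (lookup-index)
open import Data.List.Relation.Unary.Linked as Linked using (Linked; []; [-]; _∷_; _∷′_; head′)
import Data.List.Relation.Unary.Linked.Properties as Linkedₚ
open import Data.List.Relation.Unary.Unique.Propositional using (Unique; []; _∷_)
open import Data.List.Relation.Unary.Unique.Propositional.Properties as Unique using (++⁺; allFin⁺; filter⁺)
open import Data.Maybe using (Maybe; just; nothing)
import Data.Maybe as Maybe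
import Data.Maybe.Properties as Maybe
open import Data.Maybe.Relation.Binary.Connected using (just; nothing; just-nothing; nothing-just; drop-just) renaming (Connected to MaybeConnected)
open import Data.Nat using (ℕ; zero; suc; _+_; _*_; _∸_; _^_; _≤_; _<_; z≤n; s≤s; _≤?_; _<?_; NonZero; >-nonZero; >-nonZero⁻¹)
open import Data.Nat.DivMod using (_%_; _/_; _mod_; m%n<n; m≡m%n+[m/n]*n; [m+n]%n≡m%n; [m+kn]%n≡m%n; m*n/n≡m; m<n⇒m%n≡m; %-distribˡ-+; m%n%n≡m%n; n%n≡0)
open import Data.Nat.Induction using (<-wellFounded)
open import Data.Nat.ListAction using (sum)
open import Data.Nat.Properties
open import Data.Nat.Solver using (module +-*-Solver)
open import Data.Product using (∃-syntax; _×_; _,_; proj₁; proj₂)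
import Data.Product.Properties as Product
open import Data.Sum using (_⊎_; inj₁; inj₂)
open import Function using (_∘_)
open import Function.Bundles using (_⇔_; mk⇔)
open import Function.Properties.Equivalence using () renaming (trans to ⇔-trans; sym to ⇔-sym)
open import Induction.WellFounded using (Acc; acc)
open import Relation.Binary using (DecidableEquality)
open import Relation.Binary.Definitions using (tri<; tri≈; tri>)
open import Relation.Binary.PropositionalEquality hiding ([_])
open import Relation.Nullary using (¬_; yes; no; does; contradiction)
open import Relation.Nullary.Decidable using (toWitness; dec-true; dec-false)
open import Relation.Unary using (Decidable)

open +-*-Solver

-- Powers

^-distribʳ-* : ∀ m n o → (m * n) ^ o ≡ m ^ o * n ^ o
^-distribʳ-* m n zero    = refl
^-distribʳ-* m n (suc o) = begin
  m * n * (m * n) ^ o       ≡⟨ cong (m * n *_) (^-distribʳ-* m n o) ⟩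
  m * n * (m ^ o * n ^ o)   ≡⟨ solve 4 (λ m n x y → m :* n :* (x :* y) := m :* x :* (n :* y)) refl m n (m ^ o) (n ^ o) ⟩
  m * m ^ o * (n * n ^ o)   ∎
  where open ≡-Reasoning

^-cancelʳ-≤ : ∀ {m n} o .{{_ : NonZero o}} → m ^ o ≤ n ^ o → m ≤ n
^-cancelʳ-≤ {m} {n} o le with m ≤? n
... | yes m≤n = m≤n
... | no  m≰n = contradiction le (<⇒≱ (^-monoˡ-< o (≰⇒> m≰n)))

^-cancelʳ-< : ∀ {m n} o → m ^ o < n ^ o → m < n
^-cancelʳ-< {m} {n} o lt with m <? n
... | yes m<n = m<n
... | no  m≮n = contradiction lt (≤⇒≯ (^-monoˡ-≤ o (≮⇒≥ m≮n)))

[x^k]^a≡[x^a]^k : ∀ x k a → (x ^ k) ^ a ≡ (x ^ a) ^ k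
[x^k]^a≡[x^a]^k x k a = trans (^-*-assoc x k a) (trans (cong (x ^_) (*-comm k a)) (sym (^-*-assoc x a k)))

[y^a*q^b]^k≤[y^k*q^c]^a : ∀ y q a b k c .{{_ : NonZero q}} → k * b ≤ c * a → (y ^ a * q ^ b) ^ k ≤ (y ^ k * q ^ c) ^ a
[y^a*q^b]^k≤[y^k*q^c]^a y q a b k c kb≤ca = begin
  (y ^ a * q ^ b) ^ k           ≡⟨ ^-distribʳ-* (y ^ a) (q ^ b) k ⟩
  (y ^ a) ^ k * (q ^ b) ^ k     ≡⟨ cong₂ _*_ ([x^k]^a≡[x^a]^k y a k) (^-*-assoc q b k) ⟩
  (y ^ k) ^ a * q ^ (b * k)     ≤⟨ *-monoʳ-≤ ((y ^ k) ^ a) (^-monoʳ-≤ q (≤-trans (≤-reflexive (*-comm b k)) kb≤ca)) ⟩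
  (y ^ k) ^ a * q ^ (c * a)     ≡⟨ cong ((y ^ k) ^ a *_) (^-*-assoc q c a) ⟨
  (y ^ k) ^ a * (q ^ c) ^ a     ≡⟨ ^-distribʳ-* (y ^ k) (q ^ c) a ⟨
  (y ^ k * q ^ c) ^ a           ∎
  where open ≤-Reasoning

-- Read x ^ a ≤ y ^ a * q ^ b as (x / y) ^ a ≤ q ^ b: it then holds for any exponents k, c with b / a ≤ c / k.
^-bound-rescale : ∀ {x y q a b k c} .{{_ : NonZero a}} .{{_ : NonZero q}} →
                  x ^ a ≤ y ^ a * q ^ b → k * b ≤ c * a → x ^ k ≤ y ^ k * q ^ c
^-bound-rescale {x} {y} {q} {a} {b} {k} {c} bound kb≤ca = ^-cancelʳ-≤ a (begin
  (x ^ k) ^ a           ≡⟨ [x^k]^a≡[x^a]^k x k a ⟩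
  (x ^ a) ^ k           ≤⟨ ^-monoˡ-≤ k bound ⟩
  (y ^ a * q ^ b) ^ k   ≤⟨ [y^a*q^b]^k≤[y^k*q^c]^a y q a b k c kb≤ca ⟩
  (y ^ k * q ^ c) ^ a   ∎)
  where open ≤-Reasoning

^-bound-rescale-< : ∀ {x y q a b k c} → 1 < q → 0 < c →
                    x ^ a < y ^ a * q ^ b → k * b ≤ c * a → x ^ k < y ^ k * q ^ c
^-bound-rescale-< {q = q} {k = zero} {c} 1<q 0<c _ _ =
  subst (1 <_) (sym (*-identityˡ (q ^ c))) (^-monoʳ-< q 1<q 0<c)
^-bound-rescale-< {x} {y} {q} {a} {b} {k@(suc _)} {c} 1<q 0<c bound kb≤ca = ^-cancelʳ-< a (begin-strict
  (x ^ k) ^ a           ≡⟨ [x^k]^a≡[x^a]^k x k a ⟩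
  (x ^ a) ^ k           <⟨ ^-monoˡ-< k bound ⟩
  (y ^ a * q ^ b) ^ k   ≤⟨ [y^a*q^b]^k≤[y^k*q^c]^a y q a b k c {{>-nonZero (<-trans (s≤s z≤n) 1<q)}} kb≤ca ⟩
  (y ^ k * q ^ c) ^ a   ∎)
  where open ≤-Reasoning

-- Powers against exponentials

-- (1 + 1/n)^j ≤ (n + 1)/(n + 1 - j), cleared of denominators.
[1+n]^j*s≤[1+n]*n^j : ∀ n j s → j + s ≡ suc n → suc n ^ j * s ≤ suc n * n ^ j
[1+n]^j*s≤[1+n]*n^j n zero s eq = ≤-reflexive (trans (+-identityʳ s) (trans eq (sym (*-identityʳ (suc n)))))
[1+n]^j*s≤[1+n]*n^j n (suc j) s eq = begin
  suc n ^ suc j * s        ≡⟨ solve 3 (λ n x s → (con 1 :+ n) :* x :* s := x :* ((con 1 :+ n) :* s)) refl n (suc n ^ j) s ⟩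
  suc n ^ j * (suc n * s)  ≤⟨ *-monoʳ-≤ (suc n ^ j) [1+n]*s≤n*[1+s] ⟩
  suc n ^ j * (n * suc s)  ≡⟨ solve 3 (λ n x s → x :* (n :* s) := n :* (x :* s)) refl n (suc n ^ j) (suc s) ⟩
  n * (suc n ^ j * suc s)  ≤⟨ *-monoʳ-≤ n ([1+n]^j*s≤[1+n]*n^j n j (suc s) (trans (+-suc j s) eq)) ⟩
  n * (suc n * n ^ j)      ≡⟨ solve 3 (λ n a b → n :* (a :* b) := a :* (n :* b)) refl n (suc n) (n ^ j) ⟩
  suc n * n ^ suc j        ∎
  where
  open ≤-Reasoning
  [1+n]*s≤n*[1+s] : suc n * s ≤ n * suc s
  [1+n]*s≤n*[1+s] = begin
    suc n * s   ≡⟨⟩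
    s + n * s   ≤⟨ +-monoˡ-≤ (n * s) (≤-pred (≤-trans (s≤s (m≤n+m s j)) (≤-reflexive eq))) ⟩
    n + n * s   ≡⟨ *-suc n s ⟨
    n * suc s   ∎

[1+2n]^n<2*[2n]^n : ∀ n .{{_ : NonZero n}} → suc (2 * n) ^ n < 2 * (2 * n) ^ n
[1+2n]^n<2*[2n]^n n = *-cancelʳ-< (suc n) _ _ (begin-strict
  suc (2 * n) ^ n * suc n          ≤⟨ [1+n]^j*s≤[1+n]*n^j (2 * n) n (suc n) (solve 1 (λ n → n :+ (con 1 :+ n) := con 1 :+ con 2 :* n) refl n) ⟩
  suc (2 * n) * (2 * n) ^ n        <⟨ *-monoˡ-< ((2 * n) ^ n) {{m^n≢0 (2 * n) n {{m*n≢0 2 n}}}} (n<1+n (suc (2 * n))) ⟩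
  suc (suc (2 * n)) * (2 * n) ^ n  ≡⟨ solve 2 (λ n x → (con 2 :+ con 2 :* n) :* x := con 2 :* x :* (con 1 :+ n)) refl n ((2 * n) ^ n) ⟩
  2 * (2 * n) ^ n * suc n          ∎)
  where open ≤-Reasoning

^-square : ∀ x n → x ^ (2 * n) ≡ x ^ n * x ^ n
^-square x n = trans (cong (x ^_) (solve 1 (λ n → con 2 :* n := n :+ n) refl n)) (^-distribˡ-+-* x n n)

[1+n]^n<4*n^n : ∀ n .{{_ : NonZero n}} → suc n ^ n < 4 * n ^ n
[1+n]^n<4*n^n n = *-cancelʳ-< ((2 * n) ^ (2 * n)) _ _ (begin-strict
  suc n ^ n * (2 * n) ^ (2 * n)                ≡⟨ cong (suc n ^ n *_) (^-*-assoc (2 * n) 2 n) ⟨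
  suc n ^ n * ((2 * n) ^ 2) ^ n                ≡⟨ ^-distribʳ-* (suc n) ((2 * n) ^ 2) n ⟨
  (suc n * (2 * n) ^ 2) ^ n                    ≤⟨ ^-monoˡ-≤ n (≤-trans (m≤m+n _ n) (≤-reflexive square-identity)) ⟩
  (suc (2 * n) ^ 2 * n) ^ n                    ≡⟨ ^-distribʳ-* (suc (2 * n) ^ 2) n n ⟩
  (suc (2 * n) ^ 2) ^ n * n ^ n                ≡⟨ cong (_* n ^ n) (^-*-assoc (suc (2 * n)) 2 n) ⟩
  suc (2 * n) ^ (2 * n) * n ^ n                ≡⟨ cong (_* n ^ n) (^-square (suc (2 * n)) n) ⟩
  suc (2 * n) ^ n * suc (2 * n) ^ n * n ^ n    <⟨ *-monoˡ-< (n ^ n) {{m^n≢0 n n}} (*-mono-< ([1+2n]^n<2*[2n]^n n) ([1+2n]^n<2*[2n]^n n)) ⟩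
  2 * (2 * n) ^ n * (2 * (2 * n) ^ n) * n ^ n
    ≡⟨ solve 2 (λ x y → con 2 :* x :* (con 2 :* x) :* y := con 4 :* y :* (x :* x)) refl ((2 * n) ^ n) (n ^ n) ⟩
  4 * n ^ n * ((2 * n) ^ n * (2 * n) ^ n)      ≡⟨ cong (4 * n ^ n *_) (^-square (2 * n) n) ⟨
  4 * n ^ n * (2 * n) ^ (2 * n)                ∎)
  where
  open ≤-Reasoning
  square-identity : suc n * (2 * n) ^ 2 + n ≡ suc (2 * n) ^ 2 * n
  square-identity = solve 1 (λ n → (con 1 :+ n) :* ((con 2 :* n) :^ 2) :+ n := ((con 1 :+ con 2 :* n) :^ 2) :* n) refl n

[1+n]^e*m^e≤[1+m]^e*n^e : ∀ {m n} e → m ≤ n → suc n ^ e * m ^ e ≤ suc m ^ e * n ^ e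
[1+n]^e*m^e≤[1+m]^e*n^e {m} {n} e m≤n = begin
  suc n ^ e * m ^ e   ≡⟨ ^-distribʳ-* (suc n) m e ⟨
  (suc n * m) ^ e     ≤⟨ ^-monoˡ-≤ e (+-monoˡ-≤ (n * m) m≤n) ⟩
  (n + n * m) ^ e     ≡⟨ cong (λ x → (n + x) ^ e) (*-comm n m) ⟩
  (suc m * n) ^ e     ≡⟨ ^-distribʳ-* (suc m) n e ⟩
  suc m ^ e * n ^ e   ∎
  where open ≤-Reasoning

[1+n]^e<c*n^e-mono : ∀ {m n} e c .{{_ : NonZero m}} → m ≤ n → suc m ^ e < c * m ^ e → suc n ^ e < c * n ^ e
[1+n]^e<c*n^e-mono {m} {n} e c m≤n base = *-cancelʳ-< (m ^ e) _ _ (begin-strict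
  suc n ^ e * m ^ e   ≤⟨ [1+n]^e*m^e≤[1+m]^e*n^e e m≤n ⟩
  suc m ^ e * n ^ e   <⟨ *-monoˡ-< (n ^ e) {{m^n≢0 n e {{>-nonZero (≤-trans (>-nonZero⁻¹ m) m≤n)}}}} base ⟩
  c * m ^ e * n ^ e   ≡⟨ solve 3 (λ c x y → c :* x :* y := c :* y :* x) refl c (m ^ e) (n ^ e) ⟩
  c * n ^ e * m ^ e   ∎)
  where open ≤-Reasoning

module _ {α β c e m : ℕ} .{{_ : NonZero α}}
         (step : ∀ {n} → m ≤ n → suc n ^ e < c * n ^ e) (base : α * m ^ e ≤ β * c ^ m) where

  pow<exp : ∀ {n} → m < n → α * n ^ e < β * c ^ n
  pow≤exp : ∀ {n} → m ≤ n → α * n ^ e ≤ β * c ^ n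

  pow<exp {suc n} (s≤s m≤n) = begin-strict
    α * suc n ^ e       <⟨ *-monoʳ-< α (step m≤n) ⟩
    α * (c * n ^ e)     ≡⟨ solve 3 (λ a c x → a :* (c :* x) := c :* (a :* x)) refl α c (n ^ e) ⟩
    c * (α * n ^ e)     ≤⟨ *-monoʳ-≤ c (pow≤exp m≤n) ⟩
    c * (β * c ^ n)     ≡⟨ solve 3 (λ b c x → c :* (b :* x) := b :* (c :* x)) refl β c (c ^ n) ⟩
    β * c ^ suc n       ∎
    where open ≤-Reasoning

  pow≤exp m≤n with m≤n⇒m<n∨m≡n m≤n
  ... | inj₁ m<n  = <⇒≤ (pow<exp m<n)
  ... | inj₂ refl = base

[1+n]^2n<16*n^2n : ∀ n .{{_ : NonZero n}} → suc n ^ (2 * n) < 16 * n ^ (2 * n)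
[1+n]^2n<16*n^2n n = begin-strict
  suc n ^ (2 * n)              ≡⟨ ^-square (suc n) n ⟩
  suc n ^ n * suc n ^ n        <⟨ *-mono-< ([1+n]^n<4*n^n n) ([1+n]^n<4*n^n n) ⟩
  4 * n ^ n * (4 * n ^ n)      ≡⟨ solve 1 (λ x → con 4 :* x :* (con 4 :* x) := con 16 :* (x :* x)) refl (n ^ n) ⟩
  16 * (n ^ n * n ^ n)         ≡⟨ cong (16 *_) (^-square n n) ⟨
  16 * n ^ (2 * n)             ∎
  where open ≤-Reasoning

geomSum-closed : ∀ p t → p * geomSum (suc p) t + 1 ≡ suc p ^ suc t
geomSum-closed p zero    = solve 1 (λ p → p :* con 1 :+ con 1 := (con 1 :+ p) :* con 1) refl p
geomSum-closed p (suc t) = begin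
  p * (geomSum (suc p) t + suc p ^ suc t) + 1
    ≡⟨ solve 3 (λ p s x → p :* (s :+ x) :+ con 1 := (p :* s :+ con 1) :+ p :* x) refl p (geomSum (suc p) t) (suc p ^ suc t) ⟩
  (p * geomSum (suc p) t + 1) + p * suc p ^ suc t
    ≡⟨ cong (_+ p * suc p ^ suc t) (geomSum-closed p t) ⟩
  suc p ^ suc t + p * suc p ^ suc t
    ∎
  where open ≡-Reasoning

0<geomSum : ∀ x t → 0 < geomSum x t
0<geomSum x zero    = s≤s z≤n
0<geomSum x (suc t) = ≤-trans (0<geomSum x t) (m≤m+n _ _)

[x*x]^k≡x^[2k] : ∀ x k → (x * x) ^ k ≡ x ^ (2 * k)
[x*x]^k≡x^[2k] x k = trans (^-distribʳ-* x x k) (sym (^-square x k))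

[x*x*y]^k≡x^[2k]*y^k : ∀ x y k → (x * x * y) ^ k ≡ x ^ (2 * k) * y ^ k
[x*x*y]^k≡x^[2k]*y^k x y k = trans (^-distribʳ-* (x * x) y k) (cong (_* y ^ k) ([x*x]^k≡x^[2k] x k))

16≤[2+p]^[1+2[1+t]] : ∀ p t → p ≢ 0 ⊎ t ≢ 0 → 16 ≤ (2 + p) ^ (1 + 2 * suc t)
16≤[2+p]^[1+2[1+t]] zero    zero    (inj₁ p≢0) = contradiction refl p≢0
16≤[2+p]^[1+2[1+t]] zero    zero    (inj₂ t≢0) = contradiction refl t≢0
16≤[2+p]^[1+2[1+t]] zero    (suc t) _ =
  ≤-trans (m≤m+n 16 16) (^-monoʳ-≤ 2 {5} {1 + 2 * suc (suc t)} (+-monoʳ-≤ 1 (*-monoʳ-≤ 2 (s≤s (s≤s z≤n)))))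
16≤[2+p]^[1+2[1+t]] (suc p) t       _ =
  ≤-trans (m≤m+n 16 11) (≤-trans (^-monoˡ-≤ 3 (m≤m+n 3 p))
    (^-monoʳ-≤ (3 + p) {3} {1 + 2 * suc t} (+-monoʳ-≤ 1 (*-monoʳ-≤ 2 (s≤s z≤n)))))

-- The numerical bounds

module OddCount (p t n κ : ℕ) where

  q d g A N M : ℕ
  q = 2 + p
  d = 3 + p
  g = 1 + 2 * suc t
  A = d * q ^ suc t
  N = NN n d
  M = 1 + d * geomSum q t

  A≢0 : NonZero A
  A≢0 = m*n≢0 d (q ^ suc t) {{_}} {{m^n≢0 q (suc t)}}

  M*[1+p]+2≡A : M * suc p + 2 ≡ A
  M*[1+p]+2≡A = begin
    (1 + d * geomSum q t) * suc p + 2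
      ≡⟨ solve 2 (λ p s → (con 1 :+ (con 3 :+ p) :* s) :* (con 1 :+ p) :+ con 2 := (con 3 :+ p) :* ((con 1 :+ p) :* s :+ con 1))
               refl p (geomSum q t) ⟩
    d * (suc p * geomSum q t + 1)
      ≡⟨ cong (d *_) (geomSum-closed (suc p) t) ⟩
    A ∎
    where open ≡-Reasoning

  -- (1 + 1/A)^(2A) < 16 ≤ (d-1)^g, except for d = g = 3, where A = 6.
  [1+A]^2A<q^g*A^2A : suc A ^ (2 * A) < q ^ g * A ^ (2 * A)
  [1+A]^2A<q^g*A^2A with p Data.Nat.≟ 0 | t Data.Nat.≟ 0
  ... | yes refl | yes refl = toWitness {a? = 7 ^ 12 <? 8 * 6 ^ 12} _
  ... | no p≢0   | _        = <-≤-trans ([1+n]^2n<16*n^2n A {{A≢0}}) (*-monoˡ-≤ _ (16≤[2+p]^[1+2[1+t]] p t (inj₁ p≢0)))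
  ... | yes _    | no t≢0   = <-≤-trans ([1+n]^2n<16*n^2n A {{A≢0}}) (*-monoˡ-≤ _ (16≤[2+p]^[1+2[1+t]] p t (inj₂ t≢0)))

  [1+m]^2A<q^g*m^2A : ∀ {m} → A ≤ m → suc m ^ (2 * A) < q ^ g * m ^ (2 * A)
  [1+m]^2A<q^g*m^2A A≤m = [1+n]^e<c*n^e-mono (2 * A) (q ^ g) {{A≢0}} A≤m [1+A]^2A<q^g*A^2A

  q^A*A^2A≤d^2A*[q^g]^A : q ^ A * A ^ (2 * A) ≤ d ^ (2 * A) * (q ^ g) ^ A
  q^A*A^2A≤d^2A*[q^g]^A = ≤-reflexive (begin
    q ^ A * A ^ (2 * A)                             ≡⟨ cong (q ^ A *_) (^-distribʳ-* d (q ^ suc t) (2 * A)) ⟩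
    q ^ A * (d ^ (2 * A) * (q ^ suc t) ^ (2 * A))   ≡⟨ cong (λ x → q ^ A * (d ^ (2 * A) * x)) (^-*-assoc q (suc t) (2 * A)) ⟩
    q ^ A * (d ^ (2 * A) * q ^ (suc t * (2 * A)))   ≡⟨ solve 3 (λ x y z → x :* (y :* z) := y :* (x :* z)) refl (q ^ A) (d ^ (2 * A)) _ ⟩
    d ^ (2 * A) * (q ^ A * q ^ (suc t * (2 * A)))   ≡⟨ cong (d ^ (2 * A) *_) (^-distribˡ-+-* q A _) ⟨
    d ^ (2 * A) * q ^ (A + suc t * (2 * A))         ≡⟨ cong (λ e → d ^ (2 * A) * q ^ e) A+r*2A≡g*A ⟩
    d ^ (2 * A) * q ^ (g * A)                       ≡⟨ cong (d ^ (2 * A) *_) (^-*-assoc q g A) ⟨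
    d ^ (2 * A) * (q ^ g) ^ A                       ∎)
    where
    open ≡-Reasoning
    A+r*2A≡g*A : A + suc t * (2 * A) ≡ g * A
    A+r*2A≡g*A = solve 2 (λ a r → a :+ r :* (con 2 :* a) := (con 1 :+ con 2 :* r) :* a) refl A (suc t)

  core-shape : ∀ x → (x * x * q) ^ A ≡ q ^ A * x ^ (2 * A)
  core-shape x = trans ([x*x*y]^k≡x^[2k]*y^k x q A) (*-comm (x ^ (2 * A)) (q ^ A))

  rhs-shape : (d * d) ^ A * q ^ (N * g) ≡ d ^ (2 * A) * (q ^ g) ^ N
  rhs-shape = cong₂ _*_ ([x*x]^k≡x^[2k] d A) (trans (cong (q ^_) (*-comm N g)) (sym (^-*-assoc q g N)))

  core : A ≤ N → (N * N * q) ^ A ≤ (d * d) ^ A * q ^ (N * g)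
  core A≤N = subst₂ _≤_ (sym (core-shape N)) (sym rhs-shape)
    (pow≤exp {q ^ A} {d ^ (2 * A)} {q ^ g} {2 * A} {A} {{m^n≢0 q A}} [1+m]^2A<q^g*m^2A q^A*A^2A≤d^2A*[q^g]^A A≤N)

  core-< : A < N → (N * N * q) ^ A < (d * d) ^ A * q ^ (N * g)
  core-< A<N = subst₂ _<_ (sym (core-shape N)) (sym rhs-shape)
    (pow<exp {q ^ A} {d ^ (2 * A)} {q ^ g} {2 * A} {A} {{m^n≢0 q A}} [1+m]^2A<q^g*m^2A q^A*A^2A≤d^2A*[q^g]^A A<N)

  M≤n⇒A≤N : M ≤ n → A ≤ N
  M≤n⇒A≤N M≤n = subst (_≤ N) M*[1+p]+2≡A (+-monoˡ-≤ 2 (*-monoˡ-≤ (suc p) M≤n))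

  N≡A⇒n≡M : N ≡ A → n ≡ M
  N≡A⇒n≡M N≡A = *-cancelʳ-≡ n M (suc p) (+-cancelʳ-≡ 2 _ _ (trans N≡A (sym M*[1+p]+2≡A)))

  κ≤nN : κ * g ≤ n * A → M ≤ n → κ ≤ n * N
  κ≤nN κg≤nA M≤n = ≤-trans (m≤m*n κ g) (≤-trans κg≤nA (*-monoʳ-≤ n (M≤n⇒A≤N M≤n)))

  κ[Ng]≤[nN]A : κ * g ≤ n * A → κ * (N * g) ≤ n * N * A
  κ[Ng]≤[nN]A κg≤nA = begin
    κ * (N * g)   ≡⟨ solve 3 (λ k x g → k :* (x :* g) := x :* (k :* g)) refl κ N g ⟩
    N * (κ * g)   ≤⟨ *-monoʳ-≤ N κg≤nA ⟩
    N * (n * A)   ≡⟨ solve 3 (λ x n a → x :* (n :* a) := n :* x :* a) refl N n A ⟩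
    n * N * A     ∎
    where open ≤-Reasoning

  [N*N*q]^κ≡N^2κ*q^κ : (N * N * q) ^ κ ≡ N ^ (2 * κ) * q ^ κ
  [N*N*q]^κ≡N^2κ*q^κ = [x*x*y]^k≡x^[2k]*y^k N q κ

  [d*d]^κ*q^nN≡d^2κ*q^[nN∸κ]*q^κ : κ ≤ n * N → (d * d) ^ κ * q ^ (n * N) ≡ d ^ (2 * κ) * q ^ (n * N ∸ κ) * q ^ κ
  [d*d]^κ*q^nN≡d^2κ*q^[nN∸κ]*q^κ κ≤nN = begin
    (d * d) ^ κ * q ^ (n * N)                 ≡⟨ cong₂ _*_ ([x*x]^k≡x^[2k] d κ) (cong (q ^_) (sym (m∸n+n≡m κ≤nN))) ⟩
    d ^ (2 * κ) * q ^ (n * N ∸ κ + κ)         ≡⟨ cong (d ^ (2 * κ) *_) (^-distribˡ-+-* q (n * N ∸ κ) κ) ⟩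
    d ^ (2 * κ) * (q ^ (n * N ∸ κ) * q ^ κ)   ≡⟨ *-assoc (d ^ (2 * κ)) _ _ ⟨
    d ^ (2 * κ) * q ^ (n * N ∸ κ) * q ^ κ     ∎
    where open ≡-Reasoning

  oddBound : κ * g ≤ n * A → M ≤ n → OddBound n d κ
  oddBound κg≤nA M≤n = κ≤nN κg≤nA M≤n , *-cancelʳ-≤ _ _ (q ^ κ) {{m^n≢0 q κ}} (subst₂ _≤_
    [N*N*q]^κ≡N^2κ*q^κ ([d*d]^κ*q^nN≡d^2κ*q^[nN∸κ]*q^κ (κ≤nN κg≤nA M≤n))
    (^-bound-rescale {N * N * q} {d * d} {q} {A} {N * g} {κ} {n * N} {{A≢0}} (core (M≤n⇒A≤N M≤n)) (κ[Ng]≤[nN]A κg≤nA)))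

  oddEquality⇒n≡M : κ * g ≤ n * A → M ≤ n → OddEquality n d κ → n ≡ M
  oddEquality⇒n≡M κg≤nA M≤n (κ≤nN , equality) with m≤n⇒m<n∨m≡n (M≤n⇒A≤N M≤n)
  ... | inj₂ A≡N = N≡A⇒n≡M (sym A≡N)
  ... | inj₁ A<N = contradiction (cong (_* q ^ κ) equality) (<⇒≢ (subst₂ _<_
    [N*N*q]^κ≡N^2κ*q^κ ([d*d]^κ*q^nN≡d^2κ*q^[nN∸κ]*q^κ κ≤nN)
    (^-bound-rescale-< {N * N * q} {d * d} {q} {A} {N * g} {κ} {n * N} (s≤s (s≤s z≤n)) 0<nN (core-< A<N) (κ[Ng]≤[nN]A κg≤nA))))
    where
    0<nN : 0 < n * N
    0<nN = *-mono-≤ (≤-trans (s≤s z≤n) M≤n) (≤-trans (s≤s z≤n) (m≤n+m 2 (n * suc p)))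

  n≡M⇒oddEquality : n ≡ M → κ * g ≡ n * A → OddEquality n d κ
  n≡M⇒oddEquality refl κg≡nA = κ≤nN (≤-reflexive κg≡nA) ≤-refl , (begin
    N ^ (2 * κ)                          ≡⟨ cong (_^ (2 * κ)) M*[1+p]+2≡A ⟩
    (d * q ^ suc t) ^ (2 * κ)            ≡⟨ ^-distribʳ-* d (q ^ suc t) (2 * κ) ⟩
    d ^ (2 * κ) * (q ^ suc t) ^ (2 * κ)  ≡⟨ cong (d ^ (2 * κ) *_) (^-*-assoc q (suc t) (2 * κ)) ⟩
    d ^ (2 * κ) * q ^ (suc t * (2 * κ))  ≡⟨ cong (λ e → d ^ (2 * κ) * q ^ e) exponent ⟩
    d ^ (2 * κ) * q ^ (n * N ∸ κ)        ∎)
    where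
    open ≡-Reasoning
    exponent : suc t * (2 * κ) ≡ n * N ∸ κ
    exponent = begin
      suc t * (2 * κ)                ≡⟨ m+n∸m≡n κ _ ⟨
      κ + suc t * (2 * κ) ∸ κ        ≡⟨ cong (_∸ κ) (solve 2 (λ k r → k :+ r :* (con 2 :* k) := k :* (con 1 :+ con 2 :* r)) refl κ (suc t)) ⟩
      κ * g ∸ κ                      ≡⟨ cong (_∸ κ) κg≡nA ⟩
      n * A ∸ κ                      ≡⟨ cong (λ x → n * x ∸ κ) M*[1+p]+2≡A ⟨
      n * N ∸ κ                      ∎

  oddCase : κ * g ≤ n * A → M ≤ n → (n ≡ M → n * A ≤ κ * g) →
            OddBound n d κ × (OddEquality n d κ ⇔ n ≡ M)
  oddCase κg≤nA M≤n moore⇒nA≤κg = oddBound κg≤nA M≤n , mk⇔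
    (oddEquality⇒n≡M κg≤nA M≤n)
    (λ n≡M → n≡M⇒oddEquality n≡M (≤-antisym κg≤nA (moore⇒nA≤κg n≡M)))

module EvenCount (p s n κ : ℕ) where

  q d r g B N M : ℕ
  q = 2 + p
  d = 3 + p
  r = 2 + s
  g = 2 * r
  B = 2 * q ^ r
  N = NN n d
  M = 2 * geomSum q (suc s)

  B≢0 : NonZero B
  B≢0 = m*n≢0 2 (q ^ r) {{_}} {{m^n≢0 q r}}

  M*[1+p]+2≡B : M * suc p + 2 ≡ B
  M*[1+p]+2≡B = begin
    2 * geomSum q (suc s) * suc p + 2
      ≡⟨ solve 2 (λ p x → con 2 :* x :* (con 1 :+ p) :+ con 2 := con 2 :* ((con 1 :+ p) :* x :+ con 1)) refl p (geomSum q (suc s)) ⟩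
    2 * (suc p * geomSum q (suc s) + 1)
      ≡⟨ cong (2 *_) (geomSum-closed (suc p) (suc s)) ⟩
    B ∎
    where open ≡-Reasoning

  [1+m]^B<q^r*m^B : ∀ {m} → B ≤ m → suc m ^ B < q ^ r * m ^ B
  [1+m]^B<q^r*m^B B≤m = [1+n]^e<c*n^e-mono B (q ^ r) {{B≢0}} B≤m
    (<-≤-trans ([1+n]^n<4*n^n B {{B≢0}}) (*-monoˡ-≤ (B ^ B) 4≤q^r))
    where
    4≤q^r : 4 ≤ q ^ r
    4≤q^r = ≤-trans (^-monoˡ-≤ 2 (m≤m+n 2 p)) (^-monoʳ-≤ q {2} {r} (m≤m+n 2 s))

  1*B^B≤2^B*[q^r]^B : 1 * B ^ B ≤ 2 ^ B * (q ^ r) ^ B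
  1*B^B≤2^B*[q^r]^B = ≤-reflexive (trans (*-identityˡ (B ^ B)) (^-distribʳ-* 2 (q ^ r) B))

  rhs-shape : ∀ x → 2 ^ B * (q ^ r) ^ x ≡ 2 ^ B * q ^ (r * x)
  rhs-shape x = cong (2 ^ B *_) (^-*-assoc q r x)

  core : B ≤ N → N ^ B ≤ 2 ^ B * q ^ (r * N)
  core B≤N = subst₂ _≤_ (*-identityˡ (N ^ B)) (rhs-shape N)
    (pow≤exp {1} {2 ^ B} {q ^ r} {B} {B} [1+m]^B<q^r*m^B 1*B^B≤2^B*[q^r]^B B≤N)

  core-< : B < N → N ^ B < 2 ^ B * q ^ (r * N)
  core-< B<N = subst₂ _<_ (*-identityˡ (N ^ B)) (rhs-shape N)
    (pow<exp {1} {2 ^ B} {q ^ r} {B} {B} [1+m]^B<q^r*m^B 1*B^B≤2^B*[q^r]^B B<N)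

  M≤n⇒B≤N : M ≤ n → B ≤ N
  M≤n⇒B≤N M≤n = subst (_≤ N) M*[1+p]+2≡B (+-monoˡ-≤ 2 (*-monoˡ-≤ (suc p) M≤n))

  N≡B⇒n≡M : N ≡ B → n ≡ M
  N≡B⇒n≡M N≡B = *-cancelʳ-≡ n M (suc p) (+-cancelʳ-≡ 2 _ _ (trans N≡B (sym M*[1+p]+2≡B)))

  4κ[rN]≤[ndN]B : κ * g ≤ n * (d * q ^ r) → 4 * κ * (r * N) ≤ n * d * N * B
  4κ[rN]≤[ndN]B κg≤ndq^r = begin
    4 * κ * (r * N)          ≡⟨ solve 3 (λ k r x → con 4 :* k :* (r :* x) := con 2 :* x :* (k :* (con 2 :* r))) refl κ r N ⟩
    2 * N * (κ * g)          ≤⟨ *-monoʳ-≤ (2 * N) κg≤ndq^r ⟩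
    2 * N * (n * (d * q ^ r)) ≡⟨ solve 4 (λ x n d y → con 2 :* x :* (n :* (d :* y)) := n :* d :* x :* (con 2 :* y)) refl N n d (q ^ r) ⟩
    n * d * N * B            ∎
    where open ≤-Reasoning

  evenBound : κ * g ≤ n * (d * q ^ r) → M ≤ n → EvenBound n d κ
  evenBound κg≤ndq^r M≤n = ^-bound-rescale {N} {2} {q} {B} {r * N} {4 * κ} {n * d * N} {{B≢0}}
    (core (M≤n⇒B≤N M≤n)) (4κ[rN]≤[ndN]B κg≤ndq^r)

  evenEquality⇒n≡M : κ * g ≤ n * (d * q ^ r) → M ≤ n → EvenEquality n d κ → n ≡ M
  evenEquality⇒n≡M κg≤ndq^r M≤n equality with m≤n⇒m<n∨m≡n (M≤n⇒B≤N M≤n)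
  ... | inj₂ B≡N = N≡B⇒n≡M (sym B≡N)
  ... | inj₁ B<N = contradiction equality (<⇒≢ (^-bound-rescale-< {N} {2} {q} {B} {r * N} {4 * κ} {n * d * N}
    (s≤s (s≤s z≤n)) 0<ndN (core-< B<N) (4κ[rN]≤[ndN]B κg≤ndq^r)))
    where
    0<ndN : 0 < n * d * N
    0<ndN = *-mono-≤ (*-mono-≤ 0<n (s≤s z≤n)) (≤-trans (s≤s z≤n) (m≤n+m 2 (n * suc p)))
      where
      0<n : 0 < n
      0<n = ≤-trans (≤-trans (m≤m+n 1 1) (*-monoʳ-≤ 2 (0<geomSum q (suc s)))) M≤n

  n≡M⇒evenEquality : n ≡ M → κ * g ≡ n * (d * q ^ r) → EvenEquality n d κ
  n≡M⇒evenEquality refl κg≡ndq^r = begin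
    N ^ (4 * κ)                     ≡⟨ cong (_^ (4 * κ)) M*[1+p]+2≡B ⟩
    (2 * q ^ r) ^ (4 * κ)           ≡⟨ ^-distribʳ-* 2 (q ^ r) (4 * κ) ⟩
    2 ^ (4 * κ) * (q ^ r) ^ (4 * κ) ≡⟨ cong (2 ^ (4 * κ) *_) (^-*-assoc q r (4 * κ)) ⟩
    2 ^ (4 * κ) * q ^ (r * (4 * κ)) ≡⟨ cong (λ e → 2 ^ (4 * κ) * q ^ e) exponent ⟩
    2 ^ (4 * κ) * q ^ (n * d * N)   ∎
    where
    open ≡-Reasoning
    exponent : r * (4 * κ) ≡ n * d * N
    exponent = begin
      r * (4 * κ)               ≡⟨ solve 2 (λ r k → r :* (con 4 :* k) := con 2 :* (k :* (con 2 :* r))) refl r κ ⟩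
      2 * (κ * g)               ≡⟨ cong (2 *_) κg≡ndq^r ⟩
      2 * (n * (d * q ^ r))     ≡⟨ solve 3 (λ n d y → con 2 :* (n :* (d :* y)) := n :* d :* (con 2 :* y)) refl n d (q ^ r) ⟩
      n * d * B                 ≡⟨ cong (n * d *_) M*[1+p]+2≡B ⟨
      n * d * N                 ∎

  evenCase : κ * g ≤ n * (d * q ^ r) → M ≤ n → (n ≡ M → n * (d * q ^ r) ≤ κ * g) →
             EvenBound n d κ × (EvenEquality n d κ ⇔ n ≡ M)
  evenCase κg≤ndq^r M≤n moore⇒ndq^r≤κg = evenBound κg≤ndq^r M≤n , mk⇔
    (evenEquality⇒n≡M κg≤ndq^r M≤n)
    (λ n≡M → n≡M⇒evenEquality n≡M (≤-antisym κg≤ndq^r (moore⇒ndq^r≤κg n≡M)))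

-- Lists without repetition

module _ {A : Set} where

  Unique-lookup-injective : ∀ {xs : List A} → Unique xs → ∀ i j → lookup xs i ≡ lookup xs j → i ≡ j
  Unique-lookup-injective (_ ∷ _)      zero    zero    _  = refl
  Unique-lookup-injective (x∉ ∷ _)     zero    (suc j) eq = contradiction eq (All.lookup x∉ (∈-lookup j))
  Unique-lookup-injective u@(_ ∷ _)    (suc i) zero    eq = sym (Unique-lookup-injective u zero (suc i) (sym eq))
  Unique-lookup-injective (_ ∷ unique) (suc i) (suc j) eq = cong suc (Unique-lookup-injective unique i j eq)

  Unique-length-≤ : ∀ {xs ys : List A} → Unique xs → xs ⊆ ys → length xs ≤ length ys
  Unique-length-≤ {xs} {ys} unique xs⊆ys = injective⇒≤ {f = position} position-injective
    where
    position : Fin (length xs) → Fin (length ys)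
    position i = index (xs⊆ys (∈-lookup i))
    position-injective : ∀ {i j} → position i ≡ position j → i ≡ j
    position-injective {i} {j} eq = Unique-lookup-injective unique i j (begin
      lookup xs i            ≡⟨ lookup-index (xs⊆ys (∈-lookup i)) ⟩
      lookup ys (position i) ≡⟨ cong (lookup ys) eq ⟩
      lookup ys (position j) ≡⟨ lookup-index (xs⊆ys (∈-lookup j)) ⟨
      lookup xs j            ∎)
      where open ≡-Reasoning

  length-filter-reject-one : ∀ {P : A → Set} (P? : Decidable P) {xs y} → Unique xs → y ∈ xs → ¬ P y →
                             (∀ {x} → x ∈ xs → x ≢ y → P x) → suc (length (filter P? xs)) ≡ length xs
  length-filter-reject-one P? {x ∷ xs} (x∉xs ∷ _) (here refl) ¬Py accept =
    cong suc (trans (cong length (filter-reject P? ¬Py))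
                    (cong length (filter-all P? (All.tabulate λ z∈ → accept (there z∈) λ z≡x → All.lookup x∉xs z∈ (sym z≡x)))))
  length-filter-reject-one P? {x ∷ xs} {y} (x∉xs ∷ unique) (there y∈xs) ¬Py accept =
    trans (cong (λ ys → suc (length ys)) (filter-accept P? (accept (here refl) x≢y)))
          (cong suc (length-filter-reject-one P? unique y∈xs ¬Py (λ z∈ → accept (there z∈))))
    where
    x≢y : x ≢ y
    x≢y refl = All.lookup x∉xs y∈xs refl

  last-∷ʳ : ∀ (xs : List A) x → last (xs ++ [ x ]) ≡ just x
  last-∷ʳ []           x = refl
  last-∷ʳ (y ∷ [])     x = refl
  last-∷ʳ (y ∷ z ∷ xs) x = last-∷ʳ (z ∷ xs) x

  nth : A → List A → ℕ → A
  nth z []       i       = z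
  nth z (x ∷ xs) zero    = x
  nth z (x ∷ xs) (suc i) = nth z xs i

  Linked-nth : ∀ {R : A → A → Set} {z xs} → Linked R xs → ∀ {i} → suc i < length xs → R (nth z xs i) (nth z xs (suc i))
  Linked-nth [-]       {_}     (s≤s ())
  Linked-nth (r ∷ _)   {zero}  _        = r
  Linked-nth (_ ∷ rxs) {suc i} (s≤s i<) = Linked-nth rxs i<

  last-nth : ∀ z x xs → last (x ∷ xs) ≡ just (nth z (x ∷ xs) (length xs))
  last-nth z x []       = refl
  last-nth z x (y ∷ xs) = last-nth z y xs

  layers : (ℕ → List A) → ℕ → List A
  layers S zero    = []
  layers S (suc k) = layers S k ++ S k

  ∈-layers⁻ : ∀ S k {x} → x ∈ layers S k → ∃[ j ] j < k × x ∈ S j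
  ∈-layers⁻ S (suc k) x∈ with ∈-++⁻ (layers S k) x∈
  ... | inj₁ x∈layers = let j , j<k , x∈Sj = ∈-layers⁻ S k x∈layers in j , m<n⇒m<1+n j<k , x∈Sj
  ... | inj₂ x∈Sk     = k , n<1+n k , x∈Sk

  Unique-layers : ∀ S k → (∀ j → Unique (S j)) → (∀ {i j x} → x ∈ S i → x ∈ S j → i ≡ j) → Unique (layers S k)
  Unique-layers S zero    _      _        = []
  Unique-layers S (suc k) unique disjoint = ++⁺ (Unique-layers S k unique disjoint) (unique k) λ (x∈layers , x∈Sk) →
    let j , j<k , x∈Sj = ∈-layers⁻ S k x∈layers in <-irrefl (disjoint x∈Sj x∈Sk) j<k

module _ {A B : Set} where

  Unique-map-on : ∀ (f : A → B) {xs} → (∀ {x y} → x ∈ xs → y ∈ xs → f x ≡ f y → x ≡ y) → Unique xs → Unique (map f xs)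
  Unique-map-on f         _   []              = []
  Unique-map-on f {x ∷ xs} inj (x∉xs ∷ unique) =
    All-map⁺ (All.tabulate λ y∈ fx≡fy → All.lookup x∉xs y∈ (inj (here refl) (there y∈) fx≡fy)) ∷
    Unique-map-on f (λ x∈ y∈ → inj (there x∈) (there y∈)) unique

  Unique-concatMap : ∀ (f : A → List B) {xs} → Unique xs → (∀ x → Unique (f x)) →
                     (∀ {x y z} → z ∈ f x → z ∈ f y → x ≡ y) → Unique (concatMap f xs)
  Unique-concatMap f []              _        _        = []
  Unique-concatMap f {x ∷ xs} (x∉xs ∷ unique) uniqueᶠ disjoint =
    ++⁺ (uniqueᶠ x) (Unique-concatMap f unique uniqueᶠ disjoint) λ (z∈fx , z∈rest) →
      let y , y∈xs , z∈fy = find (∈-concatMap⁻ f {xs = xs} z∈rest) in All.lookup x∉xs y∈xs (disjoint z∈fx z∈fy)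

  length-concatMap : ∀ (f : A → List B) xs → length (concatMap f xs) ≡ sum (map (length ∘ f) xs)
  length-concatMap f []       = refl
  length-concatMap f (x ∷ xs) = trans (length-++ (f x)) (cong (length (f x) +_) (length-concatMap f xs))

  length-concatMap-const : ∀ (f : A → List B) c → (∀ x → length (f x) ≡ c) → ∀ xs → length (concatMap f xs) ≡ length xs * c
  length-concatMap-const f c length-f []       = refl
  length-concatMap-const f c length-f (x ∷ xs) = trans (length-++ (f x)) (cong₂ _+_ (length-f x) (length-concatMap-const f c length-f xs))

module _ {A B C : Set} where

  length-cartesianProductWith : ∀ (f : A → B → C) xs ys → length (cartesianProductWith f xs ys) ≡ length xs * length ys
  length-cartesianProductWith f []       ys = refl
  length-cartesianProductWith f (x ∷ xs) ys =
    trans (length-++ (map (f x) ys)) (cong₂ _+_ (length-map (f x) ys) (length-cartesianProductWith f xs ys))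

Unique-complete : ∀ {n} (xs : List (Fin n)) → Unique xs → length xs ≡ n → ∀ y → y ∈ xs
Unique-complete {n} xs unique length≡n y with DecMembership._∈?_ _≟ᶠ_ y xs
... | yes y∈xs = y∈xs
... | no  y∉xs = contradiction (Unique-length-≤ (¬Any⇒All¬ xs y∉xs ∷ unique) (λ {x} _ → ∈-allFin x)) λ n<n →
  <-irrefl refl (≤-trans n<n (≤-reflexive (trans (length-tabulate {n = n} (λ i → i)) (sym length≡n))))

module _ {A : Set} {n} (f : A → Fin n) {xs : List A} (unique : Unique xs)
         (injective : ∀ {x y} → x ∈ xs → y ∈ xs → f x ≡ f y → x ≡ y) where

  injectiveOn⇒length≤ : length xs ≤ n
  injectiveOn⇒length≤ = begin
    length xs          ≡⟨ length-map f xs ⟨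
    length (map f xs)  ≤⟨ Unique-length-≤ (Unique-map-on f injective unique) (λ {y} _ → ∈-allFin y) ⟩
    length (allFin n)  ≡⟨ length-tabulate {n = n} (λ i → i) ⟩
    n                  ∎
    where open ≤-Reasoning

  injectiveOn⇒surjective : length xs ≡ n → ∀ y → ∃[ x ] x ∈ xs × f x ≡ y
  injectiveOn⇒surjective length≡n y =
    let x , x∈xs , y≡fx = ∈-map⁻ f (Unique-complete (map f xs) (Unique-map-on f injective unique) (trans (length-map f xs) length≡n) y)
    in x , x∈xs , sym y≡fx

-- Residues

toℕ-mod : ∀ j k .{{_ : NonZero k}} → toℕ (j mod k) ≡ j % k
toℕ-mod j k = toℕ-fromℕ< (m%n<n j k)

mod-cong : ∀ {j j′} k .{{_ : NonZero k}} → j % k ≡ j′ % k → j mod k ≡ j′ mod k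
mod-cong {j} {j′} k eq = toℕ-injective (trans (toℕ-mod j k) (trans eq (sym (toℕ-mod j′ k))))

toℕ-mod-inverse : ∀ {k} .{{_ : NonZero k}} (i : Fin k) → toℕ i mod k ≡ i
toℕ-mod-inverse {k} i = toℕ-injective (trans (toℕ-mod (toℕ i) k) (m<n⇒m%n≡m (toℕ<n i)))

[m%n+o]%n≡[m+o]%n : ∀ m o n .{{_ : NonZero n}} → (m % n + o) % n ≡ (m + o) % n
[m%n+o]%n≡[m+o]%n m o n = begin
  (m % n + o) % n            ≡⟨ %-distribˡ-+ (m % n) o n ⟩
  (m % n % n + o % n) % n    ≡⟨ cong (λ x → (x + o % n) % n) (m%n%n≡m%n m n) ⟩
  (m % n + o % n) % n        ≡⟨ %-distribˡ-+ m o n ⟨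
  (m + o) % n                ∎
  where open ≡-Reasoning

mod-shift-comm : ∀ a b n .{{_ : NonZero n}} → (toℕ (a mod n) + b) % n ≡ (toℕ (b mod n) + a) % n
mod-shift-comm a b n = begin
  (toℕ (a mod n) + b) % n   ≡⟨ cong (λ x → (x + b) % n) (toℕ-mod a n) ⟩
  (a % n + b) % n           ≡⟨ [m%n+o]%n≡[m+o]%n a b n ⟩
  (a + b) % n               ≡⟨ cong (_% n) (+-comm a b) ⟩
  (b + a) % n               ≡⟨ [m%n+o]%n≡[m+o]%n b a n ⟨
  (b % n + a) % n           ≡⟨ cong (λ x → (x + a) % n) (toℕ-mod b n) ⟨
  (toℕ (b mod n) + a) % n   ∎
  where open ≡-Reasoning

[1+m]%n≡[1+m%n]%n : ∀ m n .{{_ : NonZero n}} → suc m % n ≡ suc (m % n) % n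
[1+m]%n≡[1+m%n]%n m n = trans (cong (_% n) (+-comm 1 m)) (trans (sym ([m%n+o]%n≡[m+o]%n m 1 n)) (cong (_% n) (+-comm (m % n) 1)))

[1+m]%n-cases : ∀ m n .{{_ : NonZero n}} → (suc (m % n) < n × suc m % n ≡ suc (m % n)) ⊎ (suc (m % n) ≡ n × suc m % n ≡ 0)
[1+m]%n-cases m n with suc (m % n) Data.Nat.≟ n
... | yes 1+m%n≡n = inj₂ (1+m%n≡n , trans ([1+m]%n≡[1+m%n]%n m n) (trans (cong (_% n) 1+m%n≡n) (n%n≡0 n)))
... | no  1+m%n≢n = inj₁ (1+m%n<n , trans ([1+m]%n≡[1+m%n]%n m n) (m<n⇒m%n≡m 1+m%n<n))
  where
  1+m%n<n : suc (m % n) < n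
  1+m%n<n = ≤∧≢⇒< (m%n<n m n) 1+m%n≢n

periodic-% : ∀ {A : Set} (f : ℕ → A) k .{{_ : NonZero k}} → (∀ j → f (j + k) ≡ f j) → ∀ j → f (j % k) ≡ f j
periodic-% f k periodic j = sym (trans (cong f (m≡m%n+[m/n]*n j k)) (iterate (j % k) (j / k)))
  where
  iterate : ∀ i t → f (i + t * k) ≡ f i
  iterate i zero    = cong f (+-identityʳ i)
  iterate i (suc t) = trans (cong f (trans (cong (i +_) (+-comm k (t * k))) (sym (+-assoc i (t * k) k)))) (trans (periodic (i + t * k)) (iterate i t))

[2+m]%n≢m%n : ∀ m n .{{_ : NonZero n}} → 3 ≤ n → suc (suc m) % n ≢ m % n
[2+m]%n≢m%n m n 3≤n eq with [1+m]%n-cases m n | [1+m]%n-cases (suc m) n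
... | inj₁ (_ , e₁)  | inj₁ (_ , e₂)  = <-irrefl (sym (trans (sym (trans e₂ (cong suc e₁))) eq)) (m<n⇒m<1+n (n<1+n (m % n)))
... | inj₁ (_ , e₁)  | inj₂ (w₂ , e₂) = <-irrefl (trans (cong (λ a → suc (suc a)) (sym (trans (sym eq) e₂))) (trans (cong suc (sym e₁)) w₂)) 3≤n
... | inj₂ (w₁ , e₁) | inj₁ (_ , e₂)  = <-irrefl (trans (cong suc (sym (trans (sym eq) (trans e₂ (cong suc e₁))))) w₁) 3≤n
... | inj₂ (w₁ , e₁) | inj₂ (w₂ , e₂) = <-irrefl (trans (cong suc (sym e₁)) w₂) (≤-trans (s≤s (s≤s z≤n)) 3≤n)

module _ (G : Graph) where

  private
    V D : Set
    V = Fin (n G)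
    D = Dart G

  -- Walks

  _≟ᵈ_ : DecidableEquality D
  _≟ᵈ_ = Product.≡-dec _≟ᶠ_ Bool._≟_

  rev-involutive : ∀ δ → rev G (rev G δ) ≡ δ
  rev-involutive (e , true)  = refl
  rev-involutive (e , false) = refl

  rev-injective : ∀ {δ δ′} → rev G δ ≡ rev G δ′ → δ ≡ δ′
  rev-injective {δ} {δ′} eq = trans (sym (rev-involutive δ)) (trans (cong (rev G) eq) (rev-involutive δ′))

  rev-≢ : ∀ δ → δ ≢ rev G δ
  rev-≢ (e , true)  ()
  rev-≢ (e , false) ()

  init-rev : ∀ δ → init G (rev G δ) ≡ term G δ
  init-rev (e , true)  = refl
  init-rev (e , false) = refl

  term-rev : ∀ δ → term G (rev G δ) ≡ init G δ
  term-rev (e , true)  = refl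
  term-rev (e , false) = refl

  map-rev-involutive : ∀ m → Maybe.map (rev G) (Maybe.map (rev G) m) ≡ m
  map-rev-involutive (just δ) = cong just (rev-involutive δ)
  map-rev-involutive nothing  = refl

  starts-at? : ∀ x → Decidable (λ δ → init G δ ≡ x)
  starts-at? x δ = init G δ ≟ᶠ x

  darts : Fin (m G) → List D
  darts e = (e , true) ∷ (e , false) ∷ []

  outgoing : V → List D
  outgoing x = concatMap (λ e → filter (starts-at? x) (darts e)) (allFin (m G))

  ∈-outgoing⁺ : ∀ {x δ} → init G δ ≡ x → δ ∈ outgoing x
  ∈-outgoing⁺ {x} {e , b} eq = ∈-concatMap⁺ _ {xs = allFin (m G)} (lose (∈-allFin e) (∈-filter⁺ (starts-at? x) (∈-darts b) eq))
    where
    ∈-darts : ∀ b → (e , b) ∈ darts e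
    ∈-darts true  = here refl
    ∈-darts false = there (here refl)

  ∈-outgoing⁻ : ∀ {x δ} → δ ∈ outgoing x → init G δ ≡ x
  ∈-outgoing⁻ {x} δ∈ with satisfied (∈-concatMap⁻ _ {xs = allFin (m G)} δ∈)
  ... | e , δ∈e = proj₂ (∈-filter⁻ (starts-at? x) {xs = darts e} δ∈e)

  Unique-outgoing : ∀ x → Unique (outgoing x)
  Unique-outgoing x = Unique-concatMap _ (allFin⁺ (m G)) (λ e → filter⁺ (starts-at? x) {xs = darts e} (((λ ()) ∷ []) ∷ [] ∷ []))
    λ {e} {e′} δ∈e δ∈e′ → trans (sym (edge (proj₁ (∈-filter⁻ (starts-at? x) {xs = darts e} δ∈e))))
                                (edge (proj₁ (∈-filter⁻ (starts-at? x) {xs = darts e′} δ∈e′)))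
    where
    edge : ∀ {e δ} → δ ∈ darts e → proj₁ δ ≡ e
    edge (here refl)         = refl
    edge (there (here refl)) = refl

  length-outgoing : ∀ x → length (outgoing x) ≡ deg G x
  length-outgoing x = trans (length-concatMap _ (allFin (m G))) (cong sum (List.map-cong darts-at-x (allFin (m G))))
    where
    darts-at-x : ∀ e → length (filter (starts-at? x) (darts e)) ≡ ind (proj₁ (ends G e)) x + ind (proj₂ (ends G e)) x
    darts-at-x e with does (proj₁ (ends G e) ≟ᶠ x)
    ... | true  with does (proj₂ (ends G e) ≟ᶠ x)
    ...   | true  = refl
    ...   | false = refl
    darts-at-x e | false with does (proj₂ (ends G e) ≟ᶠ x)
    ...   | true  = refl
    ...   | false = refl

  data IsWalk : V → List D → V → Set where
    []  : ∀ {x} → IsWalk x [] x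
    _∷_ : ∀ {x δ p y} → init G δ ≡ x → IsWalk (term G δ) p y → IsWalk x (δ ∷ p) y

  end : V → List D → V
  end x []      = x
  end x (δ ∷ p) = end (term G δ) p

  IsWalk-++ : ∀ {x y z p q} → IsWalk x p y → IsWalk y q z → IsWalk x (p ++ q) z
  IsWalk-++ []      w′ = w′
  IsWalk-++ (e ∷ w) w′ = e ∷ IsWalk-++ w w′

  IsWalk-++⁻ : ∀ {x} p {q z} → IsWalk x (p ++ q) z → IsWalk x p (end x p) × IsWalk (end x p) q z
  IsWalk-++⁻ []      w       = [] , w
  IsWalk-++⁻ (δ ∷ p) (e ∷ w) = let wp , wq = IsWalk-++⁻ p w in e ∷ wp , wq

  _⁻¹ : List D → List D
  []      ⁻¹ = []
  (δ ∷ p) ⁻¹ = p ⁻¹ ++ [ rev G δ ]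

  IsWalk-[rev] : ∀ δ → IsWalk (term G δ) [ rev G δ ] (init G δ)
  IsWalk-[rev] (e , true)  = refl ∷ []
  IsWalk-[rev] (e , false) = refl ∷ []

  IsWalk-⁻¹ : ∀ {x p y} → IsWalk x p y → IsWalk y (p ⁻¹) x
  IsWalk-⁻¹ []                  = []
  IsWalk-⁻¹ (_∷_ {δ = δ} refl w) = IsWalk-++ (IsWalk-⁻¹ w) (IsWalk-[rev] δ)

  length-⁻¹ : ∀ p → length (p ⁻¹) ≡ length p
  length-⁻¹ []      = refl
  length-⁻¹ (δ ∷ p) = trans (List.length-++ (p ⁻¹)) (trans (+-comm (length (p ⁻¹)) 1) (cong suc (length-⁻¹ p)))

  last-⁻¹ : ∀ p → last (p ⁻¹) ≡ Maybe.map (rev G) (head p)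
  last-⁻¹ []      = refl
  last-⁻¹ (δ ∷ p) = last-∷ʳ (p ⁻¹) (rev G δ)

  ⁻¹-++ : ∀ p q → (p ++ q) ⁻¹ ≡ q ⁻¹ ++ p ⁻¹
  ⁻¹-++ []      q = sym (List.++-identityʳ (q ⁻¹))
  ⁻¹-++ (δ ∷ p) q = trans (cong (_++ [ rev G δ ]) (⁻¹-++ p q)) (List.++-assoc (q ⁻¹) (p ⁻¹) _)

  ⁻¹-involutive : ∀ p → (p ⁻¹) ⁻¹ ≡ p
  ⁻¹-involutive []      = refl
  ⁻¹-involutive (δ ∷ p) = trans (⁻¹-++ (p ⁻¹) [ rev G δ ]) (cong₂ _∷_ (rev-involutive δ) (⁻¹-involutive p))

  head-⁻¹ : ∀ p → head (p ⁻¹) ≡ Maybe.map (rev G) (last p)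
  head-⁻¹ p = sym (trans (cong (Maybe.map (rev G)) (trans (cong last (sym (⁻¹-involutive p))) (last-⁻¹ (p ⁻¹))))
                         (map-rev-involutive (head (p ⁻¹))))

  -- Non-backtracking walks

  _↝_ : D → D → Set
  δ ↝ δ′ = δ′ ≢ rev G δ

  NonBacktracking : List D → Set
  NonBacktracking = Linked _↝_

  ↝-rev : ∀ {δ δ′} → δ ↝ δ′ → rev G δ′ ↝ rev G δ
  ↝-rev {δ} {δ′} δ↝δ′ eq = δ↝δ′ (sym (trans eq (rev-involutive δ′)))

  MaybeConnected-↝ : ∀ {a b} → Maybe.map (rev G) a ≢ b → MaybeConnected _↝_ a b
  MaybeConnected-↝ {just δ}  {just δ′} rev-δ≢δ′ = just (λ δ′≡rev-δ → rev-δ≢δ′ (cong just (sym δ′≡rev-δ)))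
  MaybeConnected-↝ {just δ}  {nothing} _        = just-nothing
  MaybeConnected-↝ {nothing} {just δ′} _        = nothing-just
  MaybeConnected-↝ {nothing} {nothing} _        = nothing

  MaybeConnected-nothingʳ : ∀ {o} → MaybeConnected _↝_ o nothing
  MaybeConnected-nothingʳ {just _}  = just-nothing
  MaybeConnected-nothingʳ {nothing} = nothing

  rev-↛ : ∀ δ → ¬ MaybeConnected _↝_ (just (rev G δ)) (just δ)
  rev-↛ δ (just rev-δ↝δ) = rev-δ↝δ (sym (rev-involutive δ))

  NonBacktracking-++⁻ : ∀ p {q} → NonBacktracking (p ++ q) → NonBacktracking p × NonBacktracking q
  NonBacktracking-++⁻ []           nb       = [] , nb
  NonBacktracking-++⁻ (δ ∷ [])     nb       = [-] , Linked.tail nb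
  NonBacktracking-++⁻ (δ ∷ δ′ ∷ p) (r ∷ nb) = let nbp , nbq = NonBacktracking-++⁻ (δ′ ∷ p) nb in r ∷ nbp , nbq

  MaybeConnected-rev : ∀ {δ m} → MaybeConnected _↝_ (just δ) m → MaybeConnected _↝_ (Maybe.map (rev G) m) (just (rev G δ))
  MaybeConnected-rev (just δ↝δ′)  = just (↝-rev δ↝δ′)
  MaybeConnected-rev just-nothing = nothing-just

  NonBacktracking-⁻¹ : ∀ {p} → NonBacktracking p → NonBacktracking (p ⁻¹)
  NonBacktracking-⁻¹ {[]}    _  = []
  NonBacktracking-⁻¹ {δ ∷ p} nb = Linkedₚ.++⁺ (NonBacktracking-⁻¹ (Linked.tail nb))
    (subst (λ m → MaybeConnected _↝_ m (just (rev G δ))) (sym (last-⁻¹ p)) (MaybeConnected-rev (head′ nb))) [-]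

  Follows : Maybe D → D → Set
  Follows o δ = MaybeConnected _↝_ o (just δ)

  follows? : ∀ o → Decidable (Follows o)
  follows? nothing  δ = yes nothing-just
  follows? (just ε) δ with δ ≟ᵈ rev G ε
  ... | yes δ≡rev-ε = no λ { (just ε↝δ) → ε↝δ δ≡rev-ε }
  ... | no  ε↝δ     = yes (just ε↝δ)

  -- nbWalks x o j: the non-backtracking walks of length j from x that do not backtrack along o either.
  nbWalks : V → Maybe D → ℕ → List (List D)
  nbWalksVia : D → ℕ → List (List D)
  nbWalks x o zero    = [ [] ]
  nbWalks x o (suc j) = concatMap (λ δ → nbWalksVia δ j) (filter (follows? o) (outgoing x))
  nbWalksVia δ j = map (δ ∷_) (nbWalks (term G δ) (just δ) j)

  IsNBWalk : V → Maybe D → List D → Set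
  IsNBWalk x o p = IsWalk x p (end x p) × NonBacktracking p × MaybeConnected _↝_ o (head p)

  ∈-nbWalksVia⁻ : ∀ {δ j p} → p ∈ nbWalksVia δ j → ∃[ p′ ] p ≡ δ ∷ p′ × p′ ∈ nbWalks (term G δ) (just δ) j
  ∈-nbWalksVia⁻ {δ} p∈ = let p′ , p′∈ , p≡ = ∈-map⁻ (δ ∷_) p∈ in p′ , p≡ , p′∈

  ∈-nbWalks⁻ : ∀ {x o j p} → p ∈ nbWalks x o j → IsNBWalk x o p × length p ≡ j
  ∈-nbWalks⁻ {j = zero}  (here refl) = ([] , [] , MaybeConnected-nothingʳ) , refl
  ∈-nbWalks⁻ {x} {o} {suc j} p∈ with find (∈-concatMap⁻ (λ δ → nbWalksVia δ j) {xs = filter (follows? o) (outgoing x)} p∈)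
  ... | δ , δ∈ , p∈via with ∈-nbWalksVia⁻ {δ} {j} p∈via | ∈-filter⁻ (follows? o) {xs = outgoing x} δ∈
  ... | p′ , refl , p′∈ | δ∈out , o→δ with ∈-nbWalks⁻ {j = j} p′∈
  ... | (walk , nb , δ→p′) , length≡ = (∈-outgoing⁻ δ∈out ∷ walk , δ→p′ ∷′ nb , o→δ) , cong suc length≡

  ∈-nbWalks⁺ : ∀ {x o p y} → IsWalk x p y → NonBacktracking p → MaybeConnected _↝_ o (head p) → p ∈ nbWalks x o (length p)
  ∈-nbWalks⁺ []                          _  _   = here refl
  ∈-nbWalks⁺ {x} {o} {δ ∷ p} (init≡x ∷ w) nb o→δ =
    ∈-concatMap⁺ (λ δ → nbWalksVia δ (length p)) {xs = filter (follows? o) (outgoing x)}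
      (lose (∈-filter⁺ (follows? o) (∈-outgoing⁺ init≡x) o→δ) (∈-map⁺ (δ ∷_) (∈-nbWalks⁺ w (Linked.tail nb) (head′ nb))))

  Unique-nbWalks : ∀ x o j → Unique (nbWalks x o j)
  Unique-nbWalksVia : ∀ δ j → Unique (nbWalksVia δ j)
  Unique-nbWalks x o zero    = [] ∷ []
  Unique-nbWalks x o (suc j) =
    Unique-concatMap _ (filter⁺ (follows? o) (Unique-outgoing x)) (λ δ → Unique-nbWalksVia δ j) λ {δ} {δ′} p∈ p∈′ →
      let _ , p≡ , _ = ∈-nbWalksVia⁻ {δ} {j} p∈ ; _ , p≡′ , _ = ∈-nbWalksVia⁻ {δ′} {j} p∈′
      in List.∷-injectiveˡ (trans (sym p≡) p≡′)
  Unique-nbWalksVia δ j = Unique.map⁺ List.∷-injectiveʳ (Unique-nbWalks (term G δ) (just δ) j)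

  nbWalksOfLength : ℕ → List (List D)
  nbWalksOfLength ℓ = concatMap (λ x → nbWalks x nothing ℓ) (allFin (n G))

  ∈-nbWalksOfLength⁺ : ∀ {x y p} → IsWalk x p y → NonBacktracking p → p ∈ nbWalksOfLength (length p)
  ∈-nbWalksOfLength⁺ {x} {p = p} walk nb =
    ∈-concatMap⁺ (λ x → nbWalks x nothing (length p)) {xs = allFin (n G)} (lose (∈-allFin x) (∈-nbWalks⁺ walk nb MaybeConnected-nothingˡ))
    where
    MaybeConnected-nothingˡ : ∀ {m} → MaybeConnected _↝_ nothing m
    MaybeConnected-nothingˡ {just _}  = nothing-just
    MaybeConnected-nothingˡ {nothing} = nothing

  ∈-nbWalksOfLength⁻ : ∀ {ℓ p} → p ∈ nbWalksOfLength ℓ → ∃[ x ] IsNBWalk x nothing p × length p ≡ ℓ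
  ∈-nbWalksOfLength⁻ {ℓ} p∈ =
    let x , _ , p∈x = find (∈-concatMap⁻ (λ x → nbWalks x nothing ℓ) {xs = allFin (n G)} p∈) in x , ∈-nbWalks⁻ p∈x

  Unique-nbWalksOfLength : ∀ ℓ → Unique (nbWalksOfLength (suc ℓ))
  Unique-nbWalksOfLength ℓ = Unique-concatMap _ (allFin⁺ (n G)) (λ x → Unique-nbWalks x nothing (suc ℓ)) same-start
    where
    same-start : ∀ {x x′ p} → p ∈ nbWalks x nothing (suc ℓ) → p ∈ nbWalks x′ nothing (suc ℓ) → x ≡ x′
    same-start {x} {p = []}    p∈ _   = contradiction (proj₂ (∈-nbWalks⁻ {x} {nothing} {suc ℓ} p∈)) (λ ())
    same-start {x} {x′} {δ ∷ p} p∈ p∈′ with ∈-nbWalks⁻ {x} {nothing} {suc ℓ} p∈ | ∈-nbWalks⁻ {x′} {nothing} {suc ℓ} p∈′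
    ... | ((e ∷ _) , _) , _ | ((e′ ∷ _) , _) , _ = trans (sym e) e′

  ball : V → Maybe D → ℕ → List (List D)
  ball x o R = layers (nbWalks x o) (suc R)

  ∈-ball⁻ : ∀ {x o R p} → p ∈ ball x o R → IsNBWalk x o p × length p ≤ R
  ∈-ball⁻ {x} {o} {R} p∈ =
    let j , j≤R , p∈j = ∈-layers⁻ (nbWalks x o) (suc R) p∈ ; nb , length≡j = ∈-nbWalks⁻ p∈j
    in nb , subst (_≤ R) (sym length≡j) (≤-pred j≤R)

  Unique-ball : ∀ x o R → Unique (ball x o R)
  Unique-ball x o R = Unique-layers (nbWalks x o) (suc R) (Unique-nbWalks x o)
    λ p∈i p∈j → trans (sym (proj₂ (∈-nbWalks⁻ p∈i))) (proj₂ (∈-nbWalks⁻ p∈j))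

  -- The walks from init δ that start with δ and have length ≤ R + 1, or avoid δ and have length ≤ R;
  -- they reach the vertices within distance R of the edge of δ.
  edgeBall : D → ℕ → List (List D)
  edgeBall δ R = map (δ ∷_) (ball (term G δ) (just δ) R) ++ ball (init G δ) (just (rev G δ)) R

  ∈-edgeBall⁻ : ∀ {δ R p} → p ∈ edgeBall δ R →
                (∃[ a ] p ≡ δ ∷ a × a ∈ ball (term G δ) (just δ) R) ⊎ p ∈ ball (init G δ) (just (rev G δ)) R
  ∈-edgeBall⁻ {δ} {R} p∈ with ∈-++⁻ (map (δ ∷_) (ball (term G δ) (just δ) R)) p∈
  ... | inj₁ p∈map = let a , a∈ , p≡ = ∈-map⁻ (δ ∷_) p∈map in inj₁ (a , p≡ , a∈)
  ... | inj₂ p∈ball = inj₂ p∈ball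

  Unique-edgeBall : ∀ δ R → Unique (edgeBall δ R)
  Unique-edgeBall δ R = Unique.++⁺ (Unique.map⁺ List.∷-injectiveʳ (Unique-ball (term G δ) (just δ) R)) (Unique-ball (init G δ) (just (rev G δ)) R)
    λ (p∈map , p∈ball) →
      let a , a∈ , p≡ = ∈-map⁻ (δ ∷_) p∈map ; (_ , _ , rev-δ→p) , _ = ∈-ball⁻ {init G δ} {just (rev G δ)} {R} p∈ball
      in rev-↛ δ (subst (λ p → MaybeConnected _↝_ (just (rev G δ)) (head p)) p≡ rev-δ→p)

  module _ {d} (regular : Regular G d) where

    length-followers : ∀ {x ε} → term G ε ≡ x → length (filter (follows? (just ε)) (outgoing x)) ≡ d ∸ 1
    length-followers {x} {ε} term≡x = cong (_∸ 1) (trans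
      (length-filter-reject-one (follows? (just ε)) (Unique-outgoing x) (∈-outgoing⁺ (trans (init-rev ε) term≡x))
        (λ { (just ε↝rev-ε) → ε↝rev-ε refl }) (λ _ δ≢rev-ε → just δ≢rev-ε))
      (trans (length-outgoing x) (regular x)))

    length-nbWalks-just : ∀ {x ε} j → term G ε ≡ x → length (nbWalks x (just ε) j) ≡ (d ∸ 1) ^ j
    length-nbWalksVia : ∀ δ j → length (nbWalksVia δ j) ≡ (d ∸ 1) ^ j
    length-nbWalks-just             zero    _      = refl
    length-nbWalks-just {x} {ε} (suc j) term≡x =
      trans (length-concatMap-const _ ((d ∸ 1) ^ j) (λ δ → length-nbWalksVia δ j) (filter (follows? (just ε)) (outgoing x)))
            (cong (_* (d ∸ 1) ^ j) (length-followers term≡x))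
    length-nbWalksVia δ j = trans (List.length-map (δ ∷_) (nbWalks (term G δ) (just δ) j)) (length-nbWalks-just j refl)

    length-nbWalks-nothing : ∀ x j → length (nbWalks x nothing (suc j)) ≡ d * (d ∸ 1) ^ j
    length-nbWalks-nothing x j = begin
      length (concatMap (λ δ → nbWalksVia δ j) (filter (follows? nothing) (outgoing x)))
        ≡⟨ cong (λ xs → length (concatMap (λ δ → nbWalksVia δ j) xs))
                (List.filter-all (follows? nothing) {xs = outgoing x} (All.tabulate (λ _ → nothing-just))) ⟩
      length (concatMap (λ δ → nbWalksVia δ j) (outgoing x))
        ≡⟨ length-concatMap-const _ ((d ∸ 1) ^ j) (λ δ → length-nbWalksVia δ j) (outgoing x) ⟩
      length (outgoing x) * (d ∸ 1) ^ j
        ≡⟨ cong (_* (d ∸ 1) ^ j) (trans (length-outgoing x) (regular x)) ⟩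
      d * (d ∸ 1) ^ j ∎
      where open ≡-Reasoning

    length-ball-just : ∀ {x ε} R → term G ε ≡ x → length (ball x (just ε) R) ≡ geomSum (d ∸ 1) R
    length-ball-just {x} {ε} zero term≡x = length-nbWalks-just {x} {ε} 0 term≡x
    length-ball-just {x} {ε} (suc R) term≡x =
      trans (List.length-++ (ball x (just ε) R)) (cong₂ _+_ (length-ball-just R term≡x) (length-nbWalks-just {x} {ε} (suc R) term≡x))

    length-ball-nothing : ∀ x t → length (ball x nothing (suc t)) ≡ 1 + d * geomSum (d ∸ 1) t
    length-ball-nothing x zero    = cong suc (length-nbWalks-nothing x 0)
    length-ball-nothing x (suc t) = begin
      length (ball x nothing (suc t) ++ nbWalks x nothing (suc (suc t)))
        ≡⟨ List.length-++ (ball x nothing (suc t)) ⟩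
      length (ball x nothing (suc t)) + length (nbWalks x nothing (suc (suc t)))
        ≡⟨ cong₂ _+_ (length-ball-nothing x t) (length-nbWalks-nothing x (suc t)) ⟩
      1 + d * geomSum (d ∸ 1) t + d * (d ∸ 1) ^ suc t
        ≡⟨ cong suc (sym (*-distribˡ-+ d (geomSum (d ∸ 1) t) ((d ∸ 1) ^ suc t))) ⟩
      1 + d * geomSum (d ∸ 1) (suc t) ∎
      where open ≡-Reasoning

    length-edgeBall : ∀ δ R → length (edgeBall δ R) ≡ 2 * geomSum (d ∸ 1) R
    length-edgeBall δ R = begin
      length (edgeBall δ R)
        ≡⟨ List.length-++ (map (δ ∷_) (ball (term G δ) (just δ) R)) ⟩
      length (map (δ ∷_) (ball (term G δ) (just δ) R)) + length (ball (init G δ) (just (rev G δ)) R)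
        ≡⟨ cong₂ _+_ (trans (List.length-map (δ ∷_) (ball (term G δ) (just δ) R)) (length-ball-just {ε = δ} R refl))
                     (length-ball-just {ε = rev G δ} R (term-rev δ)) ⟩
      geomSum (d ∸ 1) R + geomSum (d ∸ 1) R
        ≡⟨ cong (geomSum (d ∸ 1) R +_) (+-identityʳ (geomSum (d ∸ 1) R)) ⟨
      2 * geomSum (d ∸ 1) R ∎
      where open ≡-Reasoning

    length-nbWalksOfLength : ∀ r → length (nbWalksOfLength (suc r)) ≡ n G * (d * (d ∸ 1) ^ r)
    length-nbWalksOfLength r =
      trans (length-concatMap-const _ (d * (d ∸ 1) ^ r) (λ x → length-nbWalks-nothing x r) (allFin (n G)))
            (cong (_* (d * (d ∸ 1) ^ r)) (List.length-tabulate {n = n G} (λ i → i)))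

  -- Closed walks as periodic sequences

  IsWalk-nth : ∀ {x w y} z → IsWalk x w y → ∀ {i} → suc i < length w → term G (nth z w i) ≡ init G (nth z w (suc i))
  IsWalk-nth z (_ ∷ (e ∷ _)) {zero}  _        = sym e
  IsWalk-nth z (_ ∷ w)       {suc i} (s≤s i<) = IsWalk-nth z w i<

  IsWalk-nth-last : ∀ {x δ w y} z → IsWalk x (δ ∷ w) y → term G (nth z (δ ∷ w) (length w)) ≡ y
  IsWalk-nth-last z (_ ∷ [])      = refl
  IsWalk-nth-last z (_ ∷ (e ∷ w)) = IsWalk-nth-last z (e ∷ w)

  record PeriodicGeodesic (k : ℕ) (f : ℕ → D) : Set where
    field
      periodic        : ∀ j → f (j + k) ≡ f j
      linked          : ∀ j → term G (f j) ≡ init G (f (suc j))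
      nonBacktracking : ∀ j → f j ↝ f (suc j)

  cyclic : D → List D → ℕ → D
  cyclic δ w j = nth δ (δ ∷ w) (j % suc (length w))

  cyclic-periodicGeodesic : ∀ {x δ w} → IsWalk x (δ ∷ w) x → NonBacktracking (δ ∷ w) →
                            MaybeConnected _↝_ (last (δ ∷ w)) (just δ) → PeriodicGeodesic (suc (length w)) (cyclic δ w)
  cyclic-periodicGeodesic {x} {δ} {w} walk nb closing = record
    { periodic        = λ j → cong (nth δ (δ ∷ w)) ([m+n]%n≡m%n j k)
    ; linked          = linked
    ; nonBacktracking = nonBacktracking
    }
    where
    k : ℕ
    k = suc (length w)
    linked : ∀ j → term G (cyclic δ w j) ≡ init G (cyclic δ w (suc j))
    linked j with [1+m]%n-cases j k
    ... | inj₁ (inside , next≡) rewrite next≡ = IsWalk-nth δ walk inside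
    ... | inj₂ (wraps , next≡) rewrite next≡ | suc-injective wraps = trans (IsWalk-nth-last δ walk) (sym (head-init walk))
      where
      head-init : ∀ {x p y} → IsWalk x (δ ∷ p) y → init G δ ≡ x
      head-init (e ∷ _) = e
    nonBacktracking : ∀ j → cyclic δ w j ↝ cyclic δ w (suc j)
    nonBacktracking j with [1+m]%n-cases j k
    ... | inj₁ (inside , next≡) rewrite next≡ = Linked-nth nb inside
    ... | inj₂ (wraps , next≡) rewrite next≡ | suc-injective wraps =
      drop-just (subst (λ o → MaybeConnected _↝_ o (just δ)) (last-nth δ δ w) closing)

  periodicGeodesic⇒IsClosedGeodesic : ∀ {k f} → PeriodicGeodesic (suc k) f → IsClosedGeodesic G (suc k) (λ i → f (toℕ i))
  periodicGeodesic⇒IsClosedGeodesic {k} {f} pg =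
    (λ i → trans (linked (toℕ i)) (cong (init G) (sym (f-next i)))) ,
    (λ i eq → nonBacktracking (toℕ i) (trans (sym (f-next i)) eq))
    where
    open PeriodicGeodesic pg
    f-next : ∀ i → f (toℕ (next i)) ≡ f (suc (toℕ i))
    f-next i = trans (cong f (toℕ-mod (toℕ i + 1) (suc k))) (trans (periodic-% f (suc k) periodic (toℕ i + 1)) (cong f (+-comm (toℕ i) 1)))

  segment : (ℕ → D) → ℕ → ℕ → List D
  segment f a zero    = []
  segment f a (suc l) = f a ∷ segment f (suc a) l

  length-segment : ∀ f a l → length (segment f a l) ≡ l
  length-segment f a zero    = refl
  length-segment f a (suc l) = cong suc (length-segment f (suc a) l)

  segment-++ : ∀ f a l l′ → segment f a (l + l′) ≡ segment f a l ++ segment f (a + l) l′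
  segment-++ f a zero    l′ = cong (λ b → segment f b l′) (sym (+-identityʳ a))
  segment-++ f a (suc l) l′ =
    cong (f a ∷_) (trans (segment-++ f (suc a) l l′) (cong (λ b → segment f (suc a) l ++ segment f b l′) (sym (+-suc a l))))

  segment-cong : ∀ f h a b l → (∀ {i} → i < l → f (a + i) ≡ h (b + i)) → segment f a l ≡ segment h b l
  segment-cong f h a b zero    _  = refl
  segment-cong f h a b (suc l) eq = cong₂ _∷_
    (trans (cong f (sym (+-identityʳ a))) (trans (eq (s≤s z≤n)) (cong h (+-identityʳ b))))
    (segment-cong f h (suc a) (suc b) l λ {i} i<l → trans (cong f (sym (+-suc a i))) (trans (eq (s≤s i<l)) (cong h (+-suc b i))))

  nth-segment : ∀ z f a l {i} → i < l → nth z (segment f a l) i ≡ f (a + i)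
  nth-segment z f a (suc l) {zero}  _        = cong f (sym (+-identityʳ a))
  nth-segment z f a (suc l) {suc i} (s≤s i<) = trans (nth-segment z f (suc a) l i<) (cong f (sym (+-suc a i)))

  segment-nth-++ : ∀ z xs ys → segment (nth z (xs ++ ys)) 0 (length xs) ≡ xs
  segment-nth-++ z []       ys = refl
  segment-nth-++ z (x ∷ xs) ys = cong (x ∷_) (trans (segment-shift (length xs)) (segment-nth-++ z xs ys))
    where
    segment-shift : ∀ l {a} → segment (nth z (x ∷ xs ++ ys)) (suc a) l ≡ segment (nth z (xs ++ ys)) a l
    segment-shift zero    = refl
    segment-shift (suc l) = cong (_ ∷_) (segment-shift l)

  segment-≡⇒pointwise : ∀ {f h a b l} → segment f a l ≡ segment h b l → ∀ {i} → i < l → f (a + i) ≡ h (b + i)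
  segment-≡⇒pointwise {f} {h} {a} {b} {l} segment≡ {i} i<l =
    trans (sym (nth-segment (f a) f a l i<l)) (trans (cong (λ s → nth (f a) s i) segment≡) (nth-segment (f a) h b l i<l))

  module _ {k f} (pg : PeriodicGeodesic k f) where
    open PeriodicGeodesic pg

    IsWalk-segment : ∀ a l → IsWalk (init G (f a)) (segment f a l) (init G (f (a + l)))
    IsWalk-segment a zero    = subst (λ b → IsWalk (init G (f a)) [] (init G (f b))) (sym (+-identityʳ a)) []
    IsWalk-segment a (suc l) = refl ∷ subst₂ (λ x y → IsWalk x (segment f (suc a) l) y)
                                        (sym (linked a)) (cong (λ b → init G (f b)) (sym (+-suc a l))) (IsWalk-segment (suc a) l)

    NonBacktracking-segment : ∀ a l → NonBacktracking (segment f a l)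
    NonBacktracking-segment a zero          = []
    NonBacktracking-segment a (suc zero)    = [-]
    NonBacktracking-segment a (suc (suc l)) = nonBacktracking a ∷ NonBacktracking-segment (suc a) (suc l)

    shift-% : .{{_ : NonZero k}} → ∀ a j → f (a + j % k) ≡ f (a + j)
    shift-% a = periodic-% (λ j → f (a + j)) k (λ j → trans (cong f (sym (+-assoc a j k))) (periodic (a + j)))

  period-agree⇒agree : ∀ {k f h a b} → PeriodicGeodesic (suc k) f → PeriodicGeodesic (suc k) h →
                       segment f a (suc k) ≡ segment h b (suc k) → ∀ j → f (a + j) ≡ h (b + j)
  period-agree⇒agree {k} {a = a} {b} pf ph segment≡ j =
    trans (sym (shift-% pf a j)) (trans (segment-≡⇒pointwise segment≡ (m%n<n j (suc k))) (shift-% ph b j))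

  cycleSeq : ∀ {k} → Walk G (suc k) → ℕ → D
  cycleSeq {k} w j = w (j mod suc k)

  module _ {k} {w : Walk G (suc k)} (cycle : IsCycle G (suc k) w) where

    cycleSeq-init-injective : ∀ a b → init G (cycleSeq w a) ≡ init G (cycleSeq w b) → a % suc k ≡ b % suc k
    cycleSeq-init-injective a b init≡ = trans (sym (toℕ-mod a (suc k))) (trans (cong toℕ (proj₂ cycle _ _ init≡)) (toℕ-mod b (suc k)))

    cycleSeq-periodicGeodesic : 3 ≤ suc k → PeriodicGeodesic (suc k) (cycleSeq w)
    cycleSeq-periodicGeodesic 3≤k = record
      { periodic        = λ j → cong w (mod-cong {j + suc k} {j} (suc k) ([m+n]%n≡m%n j (suc k)))
      ; linked          = linked
      ; nonBacktracking = λ j backtrack → [2+m]%n≢m%n j (suc k) 3≤k (cycleSeq-init-injective (suc (suc j)) j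
          (trans (sym (linked (suc j))) (trans (cong (term G) backtrack) (term-rev (cycleSeq w j)))))
      }
      where
      linked : ∀ j → term G (cycleSeq w j) ≡ init G (cycleSeq w (suc j))
      linked j = trans (proj₁ cycle (j mod suc k)) (cong (λ i → init G (w i)) (mod-cong {toℕ (j mod suc k) + 1} {suc j} (suc k) (begin
        (toℕ (j mod suc k) + 1) % suc k   ≡⟨ cong (λ x → (x + 1) % suc k) (toℕ-mod j (suc k)) ⟩
        (j % suc k + 1) % suc k           ≡⟨ [m%n+o]%n≡[m+o]%n j 1 (suc k) ⟩
        (j + 1) % suc k                   ≡⟨ cong (_% suc k) (+-comm j 1) ⟩
        suc j % suc k                     ∎)))
        where open ≡-Reasoning

  -- Girth

  module _ {g} (girth : IsGirth G g) where

    g≤period : ∀ {k f} → PeriodicGeodesic (suc k) f → g ≤ suc k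
    g≤period {k} {f} pg = proj₂ girth (suc k) (s≤s z≤n) (λ i → f (toℕ i)) (periodicGeodesic⇒IsClosedGeodesic pg)

    g≤length-closedGeodesic : ∀ {x δ w} → IsWalk x (δ ∷ w) x → NonBacktracking (δ ∷ w) →
                              MaybeConnected _↝_ (last (δ ∷ w)) (just δ) → g ≤ length (δ ∷ w)
    g≤length-closedGeodesic walk nb closing = g≤period (cyclic-periodicGeodesic walk nb closing)

    -- Either w closes up without backtracking, or w = δ ∷ m ++ [ rev δ ] and m is a shorter closed walk.
    g≤length-closedNB : ∀ {x w} → IsWalk x w x → NonBacktracking w → w ≢ [] → g ≤ length w
    g≤length-closedNB {w = w} walk nb w≢[] = go w walk nb w≢[] (<-wellFounded (length w))
      where
      go : ∀ {x} w → IsWalk x w x → NonBacktracking w → w ≢ [] → Acc _<_ (length w) → g ≤ length w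
      go []      _    _  []≢[] _         = contradiction refl []≢[]
      go (δ ∷ w) walk nb _     (acc rec) with initLast w
      ... | []       = g≤length-closedGeodesic walk nb (just (λ δ≡rev-δ → rev-≢ δ δ≡rev-δ))
      ... | m ∷ʳ′ ε with δ ≟ᵈ rev G ε
      ...   | no ε↝δ = g≤length-closedGeodesic walk nb (subst (λ o → MaybeConnected _↝_ o (just δ)) (sym (last-∷ʳ (δ ∷ m) ε)) (just ε↝δ))
      ...   | yes refl with walk
      ...     | _ ∷ walk′ with IsWalk-++⁻ m walk′ | NonBacktracking-++⁻ m (Linked.tail nb)
      ...       | walk-m , (init-ε ∷ []) | nb-m , _ = ≤-trans (go m walk-m′ nb-m m≢[] (rec m<)) (<⇒≤ m<)
        where
        walk-m′ : IsWalk (term G (rev G ε)) m (term G (rev G ε))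
        walk-m′ = subst (IsWalk (term G (rev G ε)) m) (trans (sym init-ε) (sym (term-rev ε))) walk-m
        m≢[] : m ≢ []
        m≢[] refl = Linked.head nb (sym (rev-involutive ε))
        m< : length m < length (rev G ε ∷ m ++ [ ε ])
        m< = s≤s (≤-trans (m≤m+n (length m) 1) (≤-reflexive (sym (List.length-++ m))))

    g≤length-reroute : ∀ {x y p q} → IsWalk x p y → IsWalk x q y → NonBacktracking p → NonBacktracking q →
                       head p ≢ head q → g ≤ length p + length q
    g≤length-reroute {p = p} {q} wp wq nbp nbq heads≢ =
      subst (g ≤_) length≡ (g≤length-closedNB (IsWalk-++ (IsWalk-⁻¹ wq) wp) (Linkedₚ.++⁺ (NonBacktracking-⁻¹ nbq) junction nbp) nonempty)
      where
      length≡ : length (q ⁻¹ ++ p) ≡ length p + length q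
      length≡ = trans (List.length-++ (q ⁻¹)) (trans (cong (_+ length p) (length-⁻¹ q)) (+-comm (length q) (length p)))
      junction : MaybeConnected _↝_ (last (q ⁻¹)) (head p)
      junction = MaybeConnected-↝ λ eq →
        heads≢ (sym (trans (sym (map-rev-involutive (head q))) (trans (cong (Maybe.map (rev G)) (sym (last-⁻¹ q))) eq)))
      nonempty : q ⁻¹ ++ p ≢ []
      nonempty eq = heads≢ (trans (cong head (List.++-conicalʳ (q ⁻¹) p eq))
                                  (sym (cong head (trans (sym (⁻¹-involutive q)) (cong _⁻¹ (List.++-conicalˡ (q ⁻¹) p eq))))))

    g≤length-distinct : ∀ {x y p q} → IsWalk x p y → IsWalk x q y → NonBacktracking p → NonBacktracking q → p ≢ q → g ≤ length p + length q
    g≤length-distinct {p = []}    {[]}     _  _  _   _   p≢q = contradiction refl p≢q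
    g≤length-distinct {p = []}    {δ ∷ q}  wp wq nbp nbq _   = g≤length-reroute wp wq nbp nbq (λ ())
    g≤length-distinct {p = δ ∷ p} {[]}     wp wq nbp nbq _   = g≤length-reroute wp wq nbp nbq (λ ())
    g≤length-distinct {p = δ ∷ p} {δ′ ∷ q} (e ∷ wp) (e′ ∷ wq) nbp nbq p≢q with δ ≟ᵈ δ′
    ... | yes refl = ≤-trans (g≤length-distinct wp wq (Linked.tail nbp) (Linked.tail nbq) (λ p≡q → p≢q (cong (δ ∷_) p≡q)))
                             (≤-trans (n≤1+n _) (s≤s (+-monoʳ-≤ (length p) (n≤1+n (length q)))))
    ... | no δ≢δ′  = g≤length-reroute (e ∷ wp) (e′ ∷ wq) nbp nbq (λ eq → δ≢δ′ (Maybe.just-injective eq))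

    head-≢ : ∀ {x y p q} → IsWalk x p y → IsWalk x q y → NonBacktracking p → NonBacktracking q →
             p ≢ q → length p + length q ≡ g → head p ≢ head q
    head-≢ {p = []}    {[]}     _        _        _   _   p≢q _       _    = p≢q refl
    head-≢ {p = δ ∷ p} {δ′ ∷ q} (_ ∷ wp) (_ ∷ wq) nbp nbq p≢q length≡ refl = <-irrefl refl (begin-strict
      g                                 ≤⟨ g≤length-distinct wp wq (Linked.tail nbp) (Linked.tail nbq) (λ p≡q → p≢q (cong (δ ∷_) p≡q)) ⟩
      length p + length q               <⟨ s≤s (+-monoʳ-≤ (length p) (n≤1+n (length q))) ⟩
      suc (length p) + suc (length q)   ≡⟨ length≡ ⟩
      g                                 ∎)
      where open ≤-Reasoning

    last-≢ : ∀ {x y p q} → IsWalk x p y → IsWalk x q y → NonBacktracking p → NonBacktracking q →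
             p ≢ q → length p + length q ≡ g → last p ≢ last q
    last-≢ {p = p} {q} wp wq nbp nbq p≢q length≡ last≡ =
      head-≢ (IsWalk-⁻¹ wp) (IsWalk-⁻¹ wq) (NonBacktracking-⁻¹ nbp) (NonBacktracking-⁻¹ nbq)
        (λ eq → p≢q (trans (sym (⁻¹-involutive p)) (trans (cong _⁻¹ eq) (⁻¹-involutive q))))
        (trans (cong₂ _+_ (length-⁻¹ p) (length-⁻¹ q)) length≡)
        (trans (head-⁻¹ p) (trans (cong (Maybe.map (rev G)) last≡) (sym (head-⁻¹ q))))

    -- Distinct walks of total length g start and end with different darts (else dropping a common dart would
    -- leave walks too short for the girth), so out along one and back along the other never backtracks.
    closeUp : ∀ {x y δ p q} → IsWalk x (δ ∷ p) y → IsWalk x q y → NonBacktracking (δ ∷ p) → NonBacktracking q →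
              δ ∷ p ≢ q → q ≢ [] → length (δ ∷ p) + length q ≡ g →
              IsWalk x (δ ∷ p ++ q ⁻¹) x × NonBacktracking (δ ∷ p ++ q ⁻¹) × MaybeConnected _↝_ (last (δ ∷ p ++ q ⁻¹)) (just δ)
    closeUp {δ = δ} {p} {[]}     _  _  _   _   _   q≢[] _       = contradiction refl q≢[]
    closeUp {δ = δ} {p} {δ′ ∷ q} wp wq nbp nbq p≢q _    length≡ =
      IsWalk-++ wp (IsWalk-⁻¹ wq) ,
      Linkedₚ.++⁺ nbp junction (NonBacktracking-⁻¹ nbq) ,
      subst (λ o → MaybeConnected _↝_ o (just δ)) (sym last≡) (just λ δ≡ → heads≢ (cong just (trans δ≡ (rev-involutive δ′))))
      where
      heads≢ : just δ ≢ just δ′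
      heads≢ = head-≢ wp wq nbp nbq p≢q length≡
      junction : MaybeConnected _↝_ (last (δ ∷ p)) (head ((δ′ ∷ q) ⁻¹))
      junction = MaybeConnected-↝ λ eq → last-≢ wp wq nbp nbq p≢q length≡ (Maybe.map-injective rev-injective (trans eq (head-⁻¹ (δ′ ∷ q))))
      last≡ : last (δ ∷ p ++ (δ′ ∷ q) ⁻¹) ≡ just (rev G δ′)
      last≡ = trans (cong last (sym (List.++-assoc (δ ∷ p) (q ⁻¹) [ rev G δ′ ]))) (last-∷ʳ (δ ∷ p ++ q ⁻¹) (rev G δ′))

    periodicGeodesic⇒IsCycle : ∀ {k f} → PeriodicGeodesic (suc k) f → suc k ≤ g → IsCycle G (suc k) (λ i → f (toℕ i))
    periodicGeodesic⇒IsCycle {k} {f} pg k<g = proj₁ (periodicGeodesic⇒IsClosedGeodesic pg) , injective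
      where
      no-repeat : ∀ {a b} → a < b → b < suc k → init G (f a) ≢ init G (f b)
      no-repeat {a} {b} a<b b<k init≡ = <-irrefl refl (begin-strict
        length (segment f a (b ∸ a))   ≡⟨ length-segment f a (b ∸ a) ⟩
        b ∸ a                          ≤⟨ m∸n≤m b a ⟩
        b                              <⟨ ≤-trans b<k k<g ⟩
        g                              ≤⟨ g≤length-closedNB closed (NonBacktracking-segment pg a (b ∸ a)) nonempty ⟩
        length (segment f a (b ∸ a))   ∎)
        where
        open ≤-Reasoning
        closed : IsWalk (init G (f a)) (segment f a (b ∸ a)) (init G (f a))
        closed = subst (IsWalk _ _) (trans (cong (λ c → init G (f c)) (m+[n∸m]≡n (<⇒≤ a<b))) (sym init≡)) (IsWalk-segment pg a (b ∸ a))
        nonempty : segment f a (b ∸ a) ≢ []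
        nonempty eq = m>n⇒m∸n≢0 a<b (trans (sym (length-segment f a (b ∸ a))) (cong length eq))
      injective : ∀ i j → init G (f (toℕ i)) ≡ init G (f (toℕ j)) → i ≡ j
      injective i j init≡ with <-cmp (toℕ i) (toℕ j)
      ... | tri< i<j _ _ = contradiction init≡ (no-repeat i<j (toℕ<n j))
      ... | tri≈ _ i≡j _ = toℕ-injective i≡j
      ... | tri> _ _ j<i = contradiction (sym init≡) (no-repeat j<i (toℕ<n i))

    ball-end-injective : ∀ {x o R p p′} → 2 * R < g → p ∈ ball x o R → p′ ∈ ball x o R → end x p ≡ end x p′ → p ≡ p′
    ball-end-injective {x} {o} {R} {p} {p′} 2R<g p∈ p′∈ end≡ with List.≡-dec _≟ᵈ_ p p′
    ... | yes p≡p′ = p≡p′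
    ... | no  p≢p′ =
      let (wp , nbp , _) , p≤R = ∈-ball⁻ {x} {o} {R} p∈ ; (wp′ , nbp′ , _) , p′≤R = ∈-ball⁻ {x} {o} {R} p′∈
      in contradiction (g≤length-distinct wp (subst (IsWalk x p′) (sym end≡) wp′) nbp nbp′ p≢p′)
           (<⇒≱ (≤-<-trans (≤-trans (+-mono-≤ p≤R p′≤R) (≤-reflexive (cong (R +_) (sym (+-identityʳ R))))) 2R<g))

    edgeBall-crossing : ∀ {δ R a b} → suc (2 * R) < g → a ∈ ball (term G δ) (just δ) R → b ∈ ball (init G δ) (just (rev G δ)) R →
                        end (term G δ) a ≢ end (init G δ) b
    edgeBall-crossing {δ} {R} {a} {b} 1+2R<g a∈ b∈ end≡
      with ∈-ball⁻ {term G δ} {just δ} {R} a∈ | ∈-ball⁻ {init G δ} {just (rev G δ)} {R} b∈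
    ... | (wa , nba , δ→a) , a≤R | (wb , nbb , rev-δ→b) , b≤R =
      <⇒≱ (≤-<-trans (s≤s (≤-trans (+-mono-≤ a≤R b≤R) (≤-reflexive (cong (R +_) (sym (+-identityʳ R)))))) 1+2R<g)
          (g≤length-distinct (refl ∷ wa) (subst (IsWalk (init G δ) b) (sym end≡) wb) (δ→a ∷′ nba) nbb δa≢b)
      where
      δa≢b : δ ∷ a ≢ b
      δa≢b refl = rev-↛ δ rev-δ→b

    edgeBall-end-injective : ∀ {δ R p p′} → suc (2 * R) < g → p ∈ edgeBall δ R → p′ ∈ edgeBall δ R →
                             end (init G δ) p ≡ end (init G δ) p′ → p ≡ p′
    edgeBall-end-injective {δ} {R} 1+2R<g p∈ p′∈ end≡ with ∈-edgeBall⁻ {δ} {R} p∈ | ∈-edgeBall⁻ {δ} {R} p′∈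
    ... | inj₁ (a , refl , a∈) | inj₁ (a′ , refl , a′∈) =
      cong (δ ∷_) (ball-end-injective {term G δ} {just δ} {R} (<-trans (n<1+n (2 * R)) 1+2R<g) a∈ a′∈ end≡)
    ... | inj₂ b∈              | inj₂ b′∈              =
      ball-end-injective {init G δ} {just (rev G δ)} {R} (<-trans (n<1+n (2 * R)) 1+2R<g) b∈ b′∈ end≡
    ... | inj₁ (a , refl , a∈) | inj₂ b∈               = contradiction end≡ (edgeBall-crossing {δ} {R} 1+2R<g a∈ b∈)
    ... | inj₂ b∈              | inj₁ (a , refl , a∈)  = contradiction (sym end≡) (edgeBall-crossing {δ} {R} 1+2R<g a∈ b∈)

    ball-length≤ : ∀ {R} → 2 * R < g → ∀ x o → length (ball x o R) ≤ n G
    ball-length≤ {R} 2R<g x o = injectiveOn⇒length≤ (end x) (Unique-ball x o R) (ball-end-injective {x} {o} {R} 2R<g)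

    ball-covers : ∀ {R} → 2 * R < g → ∀ {x o} → length (ball x o R) ≡ n G → ∀ y → ∃[ q ] q ∈ ball x o R × end x q ≡ y
    ball-covers {R} 2R<g {x} {o} = injectiveOn⇒surjective (end x) (Unique-ball x o R) (ball-end-injective {x} {o} {R} 2R<g)

    edgeBall-length≤ : ∀ {R} → suc (2 * R) < g → ∀ δ → length (edgeBall δ R) ≤ n G
    edgeBall-length≤ {R} 1+2R<g δ = injectiveOn⇒length≤ (end (init G δ)) (Unique-edgeBall δ R) (edgeBall-end-injective {δ} {R} 1+2R<g)

    edgeBall-covers : ∀ {R} → suc (2 * R) < g → ∀ {δ} → length (edgeBall δ R) ≡ n G → ∀ y → ∃[ q ] q ∈ edgeBall δ R × end (init G δ) q ≡ y
    edgeBall-covers {R} 1+2R<g {δ} = injectiveOn⇒surjective (end (init G δ)) (Unique-edgeBall δ R) (edgeBall-end-injective {δ} {R} 1+2R<g)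

    Closable : ℕ → Set
    Closable r = ∀ {x y p} → IsWalk x p y → NonBacktracking p → length p ≡ suc r →
                 ∃[ q ] IsWalk x q y × NonBacktracking q × p ≢ q × q ≢ [] × length p + length q ≡ g

    closing-partner : ∀ {x y p q R} → IsWalk x p y → IsWalk x q y → NonBacktracking p → NonBacktracking q →
                      length q ≤ R → R < length p → g ≡ length p + R → 0 < R → p ≢ q × q ≢ [] × length p + length q ≡ g
    closing-partner {p = p} {q} {R} wp wq nbp nbq q≤R R<p g≡ 0<R = p≢q , q≢[] , trans (cong (length p +_) q≡R) (sym g≡)
      where
      p≢q : p ≢ q
      p≢q refl = <⇒≱ R<p q≤R
      q≡R : length q ≡ R
      q≡R = ≤-antisym q≤R (+-cancelˡ-≤ (length p) R (length q) (subst (_≤ length p + length q) g≡ (g≤length-distinct wp wq nbp nbq p≢q)))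
      q≢[] : q ≢ []
      q≢[] refl = <-irrefl q≡R 0<R

    ball-closable : ∀ {R} → g ≡ suc (2 * R) → 0 < R → (∀ x y → ∃[ q ] q ∈ ball x nothing R × end x q ≡ y) → Closable R
    ball-closable {R} g≡ 0<R reach {x} {y} {p} wp nbp length≡ with reach x y
    ... | q , q∈ , end≡ with ∈-ball⁻ {x} {nothing} {R} q∈
    ...   | (wq , nbq , _) , q≤R = q , wq′ , nbq , closing-partner wp wq′ nbp nbq q≤R (subst (R <_) (sym length≡) (n<1+n R)) g≡′ 0<R
      where
      wq′ : IsWalk x q y
      wq′ = subst (IsWalk x q) end≡ wq
      g≡′ : g ≡ length p + R
      g≡′ = trans g≡ (trans (cong (λ m → suc (R + m)) (+-identityʳ R)) (cong (_+ R) (sym length≡)))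

    edgeBall-closable : ∀ {R} → g ≡ 2 * suc R → 0 < R → (∀ δ y → ∃[ q ] q ∈ edgeBall δ R × end (init G δ) q ≡ y) → Closable (suc R)
    edgeBall-closable {R} g≡ 0<R reach {x} {y} {δ ∷ p} (init≡ ∷ wp) nbp length≡ with reach δ y
    ... | q , q∈ , end≡ with ∈-edgeBall⁻ {δ} {R} q∈
    ...   | inj₁ (a , refl , a∈) with ∈-ball⁻ {term G δ} {just δ} {R} a∈
    ...     | (wa , nba , _) , a≤R = contradiction (g≤length-distinct wp wa′ (Linked.tail nbp) nba p≢a) (<⇒≱ (begin-strict
              length p + length a   ≤⟨ +-mono-≤ (≤-reflexive (suc-injective length≡)) a≤R ⟩
              suc R + R             <⟨ +-monoʳ-< (suc R) (n<1+n R) ⟩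
              suc R + suc R         ≡⟨ cong (suc R +_) (+-identityʳ (suc R)) ⟨
              2 * suc R             ≡⟨ g≡ ⟨
              g                     ∎))
      where
      open ≤-Reasoning
      wa′ : IsWalk (term G δ) a y
      wa′ = subst (IsWalk (term G δ) a) end≡ wa
      p≢a : p ≢ a
      p≢a refl = 1+n≰n (subst (_≤ R) (suc-injective length≡) a≤R)
    edgeBall-closable {R} g≡ 0<R reach {x} {y} {δ ∷ p} (init≡ ∷ wp) nbp length≡ | q , q∈ , end≡ | inj₂ q∈′
      with ∈-ball⁻ {init G δ} {just (rev G δ)} {R} q∈′
    ... | (wq , nbq , _) , q≤R = q , wq′ , nbq , closing-partner (init≡ ∷ wp) wq′ nbp nbq q≤R R<δp g≡′ 0<R
      where
      wq′ : IsWalk x q y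
      wq′ = subst₂ (λ u v → IsWalk u q v) init≡ end≡ wq
      R<δp : R < length (δ ∷ p)
      R<δp = subst (R <_) (sym length≡) (≤-trans (n<1+n R) (n≤1+n (suc R)))
      g≡′ : g ≡ length (δ ∷ p) + R
      g≡′ = trans g≡ (trans (cong suc (trans (cong (R +_) (+-identityʳ (suc R))) (+-comm R (suc R)))) (cong (_+ R) (sym length≡)))

  -- Counting cycles of length g

  module _ {g′} (girth : IsGirth G (suc g′)) (3≤g : 3 ≤ suc g′) {r t} (r+t≡g : suc r + t ≡ suc g′) (2t<g : t + t < suc g′) where

    private
      g : ℕ
      g = suc g′

    -- The rest of either geodesic is a non-backtracking walk of length t between the same two vertices, and 2t < g.
    periodicGeodesics-agree : ∀ {f h} → PeriodicGeodesic g f → PeriodicGeodesic g h → ∀ a b →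
                              segment f a (suc r) ≡ segment h b (suc r) → segment f a g ≡ segment h b g
    periodicGeodesics-agree {f} {h} pf ph a b prefix≡ = begin
      segment f a g                                      ≡⟨ cong (segment f a) r+t≡g ⟨
      segment f a (suc r + t)                            ≡⟨ segment-++ f a (suc r) t ⟩
      segment f a (suc r) ++ segment f (a + suc r) t     ≡⟨ cong₂ _++_ prefix≡ rest≡ ⟩
      segment h b (suc r) ++ segment h (b + suc r) t     ≡⟨ segment-++ h b (suc r) t ⟨
      segment h b (suc r + t)                            ≡⟨ cong (segment h b) r+t≡g ⟩
      segment h b g                                      ∎
      where
      open ≡-Reasoning
      start≡ : init G (f (a + suc r)) ≡ init G (h (b + suc r))
      start≡ = begin
        init G (f (a + suc r))    ≡⟨ cong (λ i → init G (f i)) (+-suc a r) ⟩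
        init G (f (suc (a + r)))  ≡⟨ PeriodicGeodesic.linked pf (a + r) ⟨
        term G (f (a + r))        ≡⟨ cong (term G) (segment-≡⇒pointwise prefix≡ (n<1+n r)) ⟩
        term G (h (b + r))        ≡⟨ PeriodicGeodesic.linked ph (b + r) ⟩
        init G (h (suc (b + r)))  ≡⟨ cong (λ i → init G (h i)) (+-suc b r) ⟨
        init G (h (b + suc r))    ∎
      end≡ : init G (f (a + suc r + t)) ≡ init G (h (b + suc r + t))
      end≡ = begin
        init G (f (a + suc r + t))   ≡⟨ cong (init G) (wraps pf a) ⟩
        init G (f a)                 ≡⟨ cong (λ i → init G (f i)) (+-identityʳ a) ⟨
        init G (f (a + 0))           ≡⟨ cong (init G) (segment-≡⇒pointwise prefix≡ (s≤s z≤n)) ⟩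
        init G (h (b + 0))           ≡⟨ cong (λ i → init G (h i)) (+-identityʳ b) ⟩
        init G (h b)                 ≡⟨ cong (init G) (wraps ph b) ⟨
        init G (h (b + suc r + t))   ∎
        where
        wraps : ∀ {e} → PeriodicGeodesic g e → ∀ c → e (c + suc r + t) ≡ e c
        wraps {e} pe c = trans (cong e (trans (+-assoc c (suc r) t) (cong (c +_) r+t≡g))) (PeriodicGeodesic.periodic pe c)
      rest≡ : segment f (a + suc r) t ≡ segment h (b + suc r) t
      rest≡ with List.≡-dec _≟ᵈ_ (segment f (a + suc r) t) (segment h (b + suc r) t)
      ... | yes rest≡ = rest≡
      ... | no  rest≢ = contradiction
        (g≤length-distinct girth (IsWalk-segment pf (a + suc r) t)
          (subst₂ (λ u v → IsWalk u _ v) (sym start≡) (sym end≡) (IsWalk-segment ph (b + suc r) t))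
          (NonBacktracking-segment pf _ t) (NonBacktracking-segment ph _ t) rest≢)
        (<⇒≱ (subst₂ (λ x y → x + y < g) (sym (length-segment f _ t)) (sym (length-segment h _ t)) 2t<g))

    cycles-agree : ∀ {w w′} → IsCycle G g w → IsCycle G g w′ → ∀ a b →
                   segment (cycleSeq w) a (suc r) ≡ segment (cycleSeq w′) b (suc r) → ∀ k → cycleSeq w (a + k) ≡ cycleSeq w′ (b + k)
    cycles-agree {w} {w′} cycle cycle′ a b prefix≡ = period-agree⇒agree pw pw′ (periodicGeodesics-agree pw pw′ a b prefix≡)
      where
      pw : PeriodicGeodesic g (cycleSeq w)
      pw = cycleSeq-periodicGeodesic {w = w} cycle 3≤g
      pw′ : PeriodicGeodesic g (cycleSeq w′)
      pw′ = cycleSeq-periodicGeodesic {w = w′} cycle′ 3≤g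

    -- Position b of w′ is position a of w, so w′ is w rotated by a - b, that is by a + (g - b).
    agree⇒RotEquiv : ∀ {w w′ a b} → b < g → (∀ k → cycleSeq w (a + k) ≡ cycleSeq w′ (b + k)) → RotEquiv G g w w′
    agree⇒RotEquiv {w} {w′} {a} {b} b<g agree = a + (g ∸ b) , λ i → begin
      w′ i                                  ≡⟨ cong w′ (toℕ-mod-inverse i) ⟨
      cycleSeq w′ (toℕ i)                   ≡⟨ cong w′ (mod-cong {b + (toℕ i + (g ∸ b))} {toℕ i} g (wrap (toℕ i))) ⟨
      cycleSeq w′ (b + (toℕ i + (g ∸ b)))   ≡⟨ agree (toℕ i + (g ∸ b)) ⟨
      cycleSeq w (a + (toℕ i + (g ∸ b)))    ≡⟨ cong (cycleSeq w) (shuffle (toℕ i)) ⟩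
      w (shiftBy (a + (g ∸ b)) i)           ∎
      where
      open ≡-Reasoning
      wrap : ∀ x → (b + (x + (g ∸ b))) % g ≡ x % g
      wrap x = trans (cong (_% g) (trans (cong (b +_) (+-comm x (g ∸ b))) (trans (sym (+-assoc b (g ∸ b) x))
                 (trans (cong (_+ x) (m+[n∸m]≡n (<⇒≤ b<g))) (+-comm g x))))) ([m+n]%n≡m%n x g)
      shuffle : ∀ x → a + (x + (g ∸ b)) ≡ x + (a + (g ∸ b))
      shuffle x = trans (sym (+-assoc a x (g ∸ b))) (trans (cong (_+ (g ∸ b)) (+-comm a x)) (+-assoc x a (g ∸ b)))

    1+r≤g : suc r ≤ g
    1+r≤g = ≤-trans (m≤m+n (suc r) t) (≤-reflexive r+t≡g)

    closable⇒on-periodicGeodesic : Closable girth r → ∀ {p} → p ∈ nbWalksOfLength (suc r) →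
                                   ∃[ f ] PeriodicGeodesic g f × segment f 0 (suc r) ≡ p
    closable⇒on-periodicGeodesic closable {[]} p∈ with ∈-nbWalksOfLength⁻ {suc r} p∈
    ... | _ , _ , ()
    closable⇒on-periodicGeodesic closable {δ ∷ p} p∈ with ∈-nbWalksOfLength⁻ {suc r} p∈
    ... | x , (wp , nbp , _) , length≡ with closable wp nbp length≡
    ...   | q , wq , nbq , p≢q , q≢[] , length-sum with closeUp girth wp wq nbp nbq p≢q q≢[] length-sum
    ...     | wL , nbL , closing = cyclic δ (p ++ q ⁻¹) , pg , prefix≡
      where
      length-L : suc (length (p ++ q ⁻¹)) ≡ g
      length-L = trans (List.length-++ (δ ∷ p)) (trans (cong (length (δ ∷ p) +_) (length-⁻¹ q)) length-sum)
      pg : PeriodicGeodesic g (cyclic δ (p ++ q ⁻¹))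
      pg = subst (λ k → PeriodicGeodesic k (cyclic δ (p ++ q ⁻¹))) length-L (cyclic-periodicGeodesic wL nbL closing)
      prefix≡ : segment (cyclic δ (p ++ q ⁻¹)) 0 (suc r) ≡ δ ∷ p
      prefix≡ = begin
        segment (cyclic δ (p ++ q ⁻¹)) 0 (suc r)               ≡⟨ segment-cong _ _ 0 0 (suc r) within-period ⟩
        segment (nth δ (δ ∷ p ++ q ⁻¹)) 0 (suc r)              ≡⟨ cong (segment (nth δ (δ ∷ p ++ q ⁻¹)) 0) length≡ ⟨
        segment (nth δ (δ ∷ p ++ q ⁻¹)) 0 (length (δ ∷ p))     ≡⟨ segment-nth-++ δ (δ ∷ p) (q ⁻¹) ⟩
        δ ∷ p                                                  ∎
        where
        open ≡-Reasoning
        within-period : ∀ {y} → y < suc r → cyclic δ (p ++ q ⁻¹) y ≡ nth δ (δ ∷ p ++ q ⁻¹) y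
        within-period y<r = cong (nth δ (δ ∷ p ++ q ⁻¹)) (m<n⇒m%n≡m (<-≤-trans y<r (≤-trans 1+r≤g (≤-reflexive (sym length-L)))))

    module _ {κ} (kissing : IsKissingNumber G g κ) where

      private
        c : Fin κ → Walk G g
        c i = proj₁ (proj₁ kissing i)
        c-cycle : ∀ i → IsCycle G g (c i)
        c-cycle i = proj₂ (proj₁ kissing i)

      prefix : Fin κ → Fin g → List D
      prefix i s = segment (cycleSeq (c i)) (toℕ s) (suc r)

      prefix-injective : ∀ {i j s s′} → prefix i s ≡ prefix j s′ → i ≡ j × s ≡ s′
      prefix-injective {i} {j} {s} {s′} prefix≡
        with proj₁ (proj₂ kissing) i j (agree⇒RotEquiv {c i} {c j} {toℕ s} {toℕ s′} (toℕ<n s′)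
               (cycles-agree {c i} {c j} (c-cycle i) (c-cycle j) (toℕ s) (toℕ s′) prefix≡))
      ... | refl = refl , toℕ-injective (begin
        toℕ s          ≡⟨ m<n⇒m%n≡m (toℕ<n s) ⟨
        toℕ s % g      ≡⟨ cycleSeq-init-injective {w = c i} (c-cycle i) (toℕ s) (toℕ s′) (cong (init G) start≡) ⟩
        toℕ s′ % g     ≡⟨ m<n⇒m%n≡m (toℕ<n s′) ⟩
        toℕ s′         ∎)
        where
        open ≡-Reasoning
        start≡ : cycleSeq (c i) (toℕ s) ≡ cycleSeq (c i) (toℕ s′)
        start≡ = subst₂ (λ a b → cycleSeq (c i) a ≡ cycleSeq (c i) b) (+-identityʳ (toℕ s)) (+-identityʳ (toℕ s′))
                   (cycles-agree {c i} {c i} (c-cycle i) (c-cycle i) (toℕ s) (toℕ s′) prefix≡ 0)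

      prefixes : List (List D)
      prefixes = cartesianProductWith prefix (allFin κ) (allFin g)

      length-prefixes : length prefixes ≡ κ * g
      length-prefixes = trans (length-cartesianProductWith prefix (allFin κ) (allFin g))
                              (cong₂ _*_ (List.length-tabulate {n = κ} (λ i → i)) (List.length-tabulate {n = g} (λ i → i)))

      prefix-nbWalk : ∀ i s → prefix i s ∈ nbWalksOfLength (suc r)
      prefix-nbWalk i s = subst (λ ℓ → prefix i s ∈ nbWalksOfLength ℓ) (length-segment (cycleSeq (c i)) (toℕ s) (suc r))
        (∈-nbWalksOfLength⁺ (IsWalk-segment pg (toℕ s) (suc r)) (NonBacktracking-segment pg (toℕ s) (suc r)))
        where
        pg : PeriodicGeodesic g (cycleSeq (c i))
        pg = cycleSeq-periodicGeodesic {w = c i} (c-cycle i) 3≤g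

      prefixes⊆nbWalks : prefixes ⊆ nbWalksOfLength (suc r)
      prefixes⊆nbWalks p∈ = let i , s , _ , _ , p≡ = ∈-cartesianProductWith⁻ prefix (allFin κ) (allFin g) p∈
                            in subst (_∈ nbWalksOfLength (suc r)) (sym p≡) (prefix-nbWalk i s)

      Unique-prefixes : Unique prefixes
      Unique-prefixes = Unique.cartesianProductWith⁺ prefix prefix-injective (allFin⁺ κ) (allFin⁺ g)

      κ*g≤ : ∀ {d} → Regular G d → κ * g ≤ n G * (d * (d ∸ 1) ^ r)
      κ*g≤ {d} regular = begin
        κ * g                                     ≡⟨ length-prefixes ⟨
        length prefixes                           ≤⟨ Unique-length-≤ Unique-prefixes prefixes⊆nbWalks ⟩
        length (nbWalksOfLength (suc r))          ≡⟨ length-nbWalksOfLength regular r ⟩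
        n G * (d * (d ∸ 1) ^ r)                   ∎
        where open ≤-Reasoning

      periodicGeodesic⇒prefix : ∀ {f} → PeriodicGeodesic g f → ∃[ i ] ∃[ s ] prefix i s ≡ segment f 0 (suc r)
      periodicGeodesic⇒prefix {f} pg with proj₂ (proj₂ kissing) ((λ j → f (toℕ j)) , periodicGeodesic⇒IsCycle girth pg ≤-refl)
      ... | i , ρ , rotation = i , ρ mod g , segment-cong _ _ _ _ (suc r) on-cycle
        where
        on-cycle : ∀ {y} → y < suc r → cycleSeq (c i) (toℕ (ρ mod g) + y) ≡ f (0 + y)
        on-cycle {y} y<r = begin
          c i ((toℕ (ρ mod g) + y) mod g)   ≡⟨ cong (c i) (mod-cong {toℕ (ρ mod g) + y} {toℕ (y mod g) + ρ} g (mod-shift-comm ρ y g)) ⟩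
          c i (shiftBy ρ (y mod g))         ≡⟨ rotation (y mod g) ⟨
          f (toℕ (y mod g))                 ≡⟨ cong f (trans (toℕ-mod y g) (m<n⇒m%n≡m (<-≤-trans y<r 1+r≤g))) ⟩
          f y                               ∎
          where open ≡-Reasoning

      closable⇒prefix : Closable girth r → ∀ {p} → p ∈ nbWalksOfLength (suc r) → ∃[ i ] ∃[ s ] prefix i s ≡ p
      closable⇒prefix closable p∈ =
        let f , pg , segment≡p = closable⇒on-periodicGeodesic closable p∈ ; i , s , prefix≡ = periodicGeodesic⇒prefix pg
        in i , s , trans prefix≡ segment≡p

      closable⇒nbWalks⊆prefixes : Closable girth r → nbWalksOfLength (suc r) ⊆ prefixes
      closable⇒nbWalks⊆prefixes closable p∈ = let i , s , p≡ = closable⇒prefix closable p∈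
                                              in subst (_∈ prefixes) p≡ (∈-cartesianProductWith⁺ prefix (∈-allFin i) (∈-allFin s))

      ≤κ*g : ∀ {d} → Regular G d → Closable girth r → n G * (d * (d ∸ 1) ^ r) ≤ κ * g
      ≤κ*g {d} regular closable = begin
        n G * (d * (d ∸ 1) ^ r)            ≡⟨ length-nbWalksOfLength regular r ⟨
        length (nbWalksOfLength (suc r))   ≤⟨ Unique-length-≤ (Unique-nbWalksOfLength r) (closable⇒nbWalks⊆prefixes closable) ⟩
        length prefixes                    ≡⟨ length-prefixes ⟩
        κ * g                              ∎
        where open ≤-Reasoning

odd-decomposition : ∀ {g} → 3 ≤ g → g % 2 ≡ 1 → ∃[ t ] g ≡ 1 + 2 * suc t
odd-decomposition {g} 3≤g g-odd with g / 2 | m≡m%n+[m/n]*n g 2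
... | zero  | g≡ = contradiction (subst (3 ≤_) (trans g≡ (cong (_+ 0) g-odd)) 3≤g) λ { (s≤s ()) }
... | suc t | g≡ = t , trans g≡ (trans (cong (_+ suc t * 2) g-odd) (cong suc (*-comm (suc t) 2)))

even-decomposition : ∀ {g} → 3 ≤ g → g % 2 ≡ 0 → ∃[ s ] g ≡ 2 * (2 + s)
even-decomposition {g} 3≤g g-even with g / 2 | m≡m%n+[m/n]*n g 2
... | zero        | g≡ = contradiction (subst (3 ≤_) (trans g≡ (cong (_+ 0) g-even)) 3≤g) λ ()
... | suc zero    | g≡ = contradiction (subst (3 ≤_) (trans g≡ (cong (_+ 2) g-even)) 3≤g) λ { (s≤s (s≤s ())) }
... | suc (suc s) | g≡ = s , trans g≡ (trans (cong (_+ (2 + s) * 2) g-even) (*-comm (2 + s) 2))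

if-true : ∀ {A : Set} {b} {x y : A} → b ≡ true → (if b then x else y) ≡ x
if-true refl = refl

if-false : ∀ {A : Set} {b} {x y : A} → b ≡ false → (if b then x else y) ≡ y
if-false refl = refl

MooreSize-odd : ∀ d t → MooreSize d (1 + 2 * suc t) ≡ 1 + d * geomSum (d ∸ 1) t
MooreSize-odd d t = begin
  MooreSize d g                                  ≡⟨ if-true (dec-true (g % 2 Data.Nat.≟ 1) g-odd) ⟩
  1 + d * geomSum (d ∸ 1) ((g ∸ 3) / 2)           ≡⟨ cong (λ x → 1 + d * geomSum (d ∸ 1) (x / 2)) g∸3≡t*2 ⟩
  1 + d * geomSum (d ∸ 1) (t * 2 / 2)             ≡⟨ cong (λ x → 1 + d * geomSum (d ∸ 1) x) (m*n/n≡m t 2) ⟩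
  1 + d * geomSum (d ∸ 1) t                       ∎
  where
  open ≡-Reasoning
  g : ℕ
  g = 1 + 2 * suc t
  g-odd : g % 2 ≡ 1
  g-odd = trans (cong (_% 2) (solve 1 (λ t → con 1 :+ con 2 :* (con 1 :+ t) := con 1 :+ (con 1 :+ t) :* con 2) refl t)) ([m+kn]%n≡m%n 1 (suc t) 2)
  g∸3≡t*2 : g ∸ 3 ≡ t * 2
  g∸3≡t*2 = cong (_∸ 3) (solve 1 (λ t → con 1 :+ con 2 :* (con 1 :+ t) := con 3 :+ t :* con 2) refl t)

MooreSize-even : ∀ d s → MooreSize d (2 * (2 + s)) ≡ 2 * geomSum (d ∸ 1) (suc s)
MooreSize-even d s = begin
  MooreSize d g                                  ≡⟨ if-false (dec-false (g % 2 Data.Nat.≟ 1) g-not-odd) ⟩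
  2 * geomSum (d ∸ 1) ((g ∸ 2) / 2)               ≡⟨ cong (λ x → 2 * geomSum (d ∸ 1) (x / 2)) g∸2≡[1+s]*2 ⟩
  2 * geomSum (d ∸ 1) (suc s * 2 / 2)             ≡⟨ cong (λ x → 2 * geomSum (d ∸ 1) x) (m*n/n≡m (suc s) 2) ⟩
  2 * geomSum (d ∸ 1) (suc s)                     ∎
  where
  open ≡-Reasoning
  g : ℕ
  g = 2 * (2 + s)
  g-even : g % 2 ≡ 0
  g-even = trans (cong (_% 2) (solve 1 (λ s → con 2 :* (con 2 :+ s) := con 0 :+ (con 2 :+ s) :* con 2) refl s)) ([m+kn]%n≡m%n 0 (2 + s) 2)
  g-not-odd : g % 2 ≢ 1
  g-not-odd odd = 0≢1+n (trans (sym g-even) odd)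
  g∸2≡[1+s]*2 : g ∸ 2 ≡ suc s * 2
  g∸2≡[1+s]*2 = cong (_∸ 2) (solve 1 (λ s → con 2 :* (con 2 :+ s) := con 2 :+ (con 1 :+ s) :* con 2) refl s)

girth-dart : ∀ {G g′} → IsGirth G (suc g′) → Dart G
girth-dart girth = proj₁ (proj₂ (proj₁ girth)) zero

IsMoore⇔ : ∀ {G d g M} → Connected G → Regular G d → IsGirth G g → MooreSize d g ≡ M → IsMoore G d g ⇔ (n G ≡ M)
IsMoore⇔ connected regular girth size≡M =
  mk⇔ (λ (_ , _ , _ , n≡size) → trans n≡size size≡M) (λ n≡M → connected , regular , girth , trans n≡M (sym size≡M))

oddGirth : ∀ p (G : Graph) → Connected G → Regular G (3 + p) → ∀ {g′} → IsGirth G (suc g′) → 3 ≤ suc g′ →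
           ∀ {κ} → IsKissingNumber G (suc g′) κ → suc g′ % 2 ≡ 1 →
           OddBound (n G) (3 + p) κ × (OddEquality (n G) (3 + p) κ ⇔ IsMoore G (3 + p) (suc g′))
oddGirth p G connected regular girth 3≤g {κ} kissing g-odd with odd-decomposition 3≤g g-odd
... | t , refl =
  let bound , equality⇔n≡M = oddCase (κ*g≤ G girth 3≤g {R} {R} R+R≡g R+R<g kissing regular) M≤n
                               (λ n≡M → ≤κ*g G girth 3≤g {R} {R} R+R≡g R+R<g kissing regular (moore⇒closable n≡M))
  in bound , ⇔-trans equality⇔n≡M (⇔-sym (IsMoore⇔ connected regular girth (MooreSize-odd (3 + p) t)))
  where
  open OddCount p t (n G) κ
  R : ℕ
  R = suc t
  R+R≡g : suc R + R ≡ g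
  R+R≡g = cong (λ m → suc (R + m)) (sym (+-identityʳ R))
  R+R<g : R + R < g
  R+R<g = s≤s (≤-reflexive (cong (R +_) (sym (+-identityʳ R))))
  2R<g : 2 * R < g
  2R<g = ≤-refl
  ball-size : ∀ x → length (ball G x nothing R) ≡ M
  ball-size x = length-ball-nothing G regular x t
  M≤n : M ≤ n G
  M≤n = let x = init G (girth-dart girth) in subst (_≤ n G) (ball-size x) (ball-length≤ G girth {R} 2R<g x nothing)
  moore⇒closable : n G ≡ M → Closable G girth R
  moore⇒closable n≡M = ball-closable G girth refl (s≤s z≤n) λ x → ball-covers G girth {R} 2R<g {x} {nothing} (trans (ball-size x) (sym n≡M))

evenGirth : ∀ p (G : Graph) → Connected G → Regular G (3 + p) → ∀ {g′} → IsGirth G (suc g′) → 3 ≤ suc g′ →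
            ∀ {κ} → IsKissingNumber G (suc g′) κ → suc g′ % 2 ≡ 0 →
            EvenBound (n G) (3 + p) κ × (EvenEquality (n G) (3 + p) κ ⇔ IsMoore G (3 + p) (suc g′))
evenGirth p G connected regular girth 3≤g {κ} kissing g-even with even-decomposition 3≤g g-even
... | s , refl =
  let bound , equality⇔n≡M = evenCase (κ*g≤ G girth 3≤g {suc R} {R} [1+R]+R≡g R+R<g kissing regular) M≤n
                               (λ n≡M → ≤κ*g G girth 3≤g {suc R} {R} [1+R]+R≡g R+R<g kissing regular (moore⇒closable n≡M))
  in bound , ⇔-trans equality⇔n≡M (⇔-sym (IsMoore⇔ connected regular girth (MooreSize-even (3 + p) s)))
  where
  open EvenCount p s (n G) κ
  R : ℕ
  R = suc s
  g≡ : g ≡ suc (suc (R + R))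
  g≡ = solve 1 (λ s → con 2 :* (con 2 :+ s) := con 2 :+ ((con 1 :+ s) :+ (con 1 :+ s))) refl s
  [1+R]+R≡g : suc (suc R) + R ≡ g
  [1+R]+R≡g = sym g≡
  R+R<g : R + R < g
  R+R<g = subst (R + R <_) (sym g≡) (s≤s (n≤1+n _))
  1+2R<g : suc (2 * R) < g
  1+2R<g = subst (suc (2 * R) <_) (sym g≡) (s≤s (s≤s (≤-reflexive (cong (R +_) (+-identityʳ R)))))
  edgeBall-size : ∀ δ → length (edgeBall G δ R) ≡ M
  edgeBall-size δ = length-edgeBall G regular δ R
  M≤n : M ≤ n G
  M≤n = subst (_≤ n G) (edgeBall-size (girth-dart girth)) (edgeBall-length≤ G girth {R} 1+2R<g (girth-dart girth))
  moore⇒closable : n G ≡ M → Closable G girth (suc R)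
  moore⇒closable n≡M = edgeBall-closable G girth refl (s≤s z≤n) λ δ → edgeBall-covers G girth {R} 1+2R<g {δ} (trans (edgeBall-size δ) (sym n≡M))

corollary1p2 : (d : ℕ) → 3 ≤ d → (G : Graph) → Connected G → Regular G d →
    (g : ℕ) → 3 ≤ g → IsGirth G g → (κ : ℕ) → IsKissingNumber G g κ →
    (g % 2 ≡ 1 → OddBound (n G) d κ × (OddEquality (n G) d κ ⇔ IsMoore G d g)) ×
    (g % 2 ≡ 0 → EvenBound (n G) d κ × (EvenEquality (n G) d κ ⇔ IsMoore G d g))
corollary1p2 (suc (suc (suc p))) _ G connected regular (suc g′) 3≤g girth κ kissing =
  oddGirth p G connected regular girth 3≤g kissing , evenGirth p G connected regular girth 3≤g kissing
corollary1p2 (suc (suc (suc p))) _ G _ _ zero () _ _ _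
corollary1p2 0       () _ _ _ _ _ _ _ _
corollary1p2 1       (s≤s ()) _ _ _ _ _ _ _ _
corollary1p2 2       (s≤s (s≤s ())) _ _ _ _ _ _ _ _
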